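{- A tree $T$ belongs to $\mathcal{G}^{\mathrm{cs}}$ if and only if $T$ is a double star.
   Context: All graphs are finite and simple. A double star is a tree of diameter at most three. A weight function on $V(G)$ is a map $w:V(G)\to\mathbb{R}_{>0}$; for $X\subseteq V(G)$ put $w(X)=\sum_{v\in X}w(v)$. A non-empty set $S\subseteq V(G)$ is a weighted safe set of $(G,w)$ if for every component $C$ of the induced subgraph $G[S]$ and every component $D$ of $G-S$ such that some edge joins $C$ and $D$, we have $w(C)\ge w(D)$. It is a connected weighted safe set if moreover $G[S]$ is connected. $\mathrm{s}(G,w)$ (resp. $\mathrm{cs}(G,w)$) is the minimum of $w(S)$ over all weighted safe sets (resp. connected weighted safe sets) $S$ of $(G,w)$. $\mathcal{G}^{\mathrm{cs}}$ denotes the family of all graphs $G$ such that $\mathrm{s}(G,w)=\mathrm{cs}(G,w)$ for every weight function $w$ on $V(G)$.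
   Formalization: The weight functions defining $\mathcal{G}^{\mathrm{cs}}$ take positive rational values instead of positive real values. -}

module Defs where

open import Data.Nat using (ℕ; zero; suc; _≤_)
open import Data.Fin using (Fin; zero; suc)
open import Data.Bool using (Bool; true; false; if_then_else_)
open import Data.Vec using (Vec; []; _∷_)
open import Data.List using (List; []; _∷_; length)
open import Data.List.Relation.Unary.Unique.Propositional using (Unique)
open import Data.Fin.Subset using (Subset; _∈_; _∉_; _⊆_; ∁; Nonempty)
open import Data.Product using (Σ; _×_; ∃; ∃-syntax)
open import Data.Sum using (_⊎_)
open import Data.Empty using (⊥)
open import Relation.Binary.PropositionalEquality using (_≡_)
open import Data.Rational using (ℚ; 0ℚ; _+_) renaming (_≤_ to _≤ℚ_; _<_ to _<ℚ_)

record Graph (n : ℕ) : Set where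
  field
    adj    : Fin n → Fin n → Bool
    sym    : ∀ u v → adj u v ≡ adj v u
    irrefl : ∀ u → adj u u ≡ false
open Graph public

Adj : ∀ {n} → Graph n → Fin n → Fin n → Set
Adj G u v = adj G u v ≡ true

data Reach {n : ℕ} (G : Graph n) (X : Subset n) : Fin n → Fin n → Set where
  here : ∀ {u} → u ∈ X → Reach G X u u
  step : ∀ {u v w} → Reach G X u v → Adj G v w → w ∈ X → Reach G X u w

ConnectedIn : ∀ {n} → Graph n → Subset n → Set
ConnectedIn G X = ∀ u v → u ∈ X → v ∈ X → Reach G X u v

full : ∀ {n} → Subset n
full {zero} = []
full {suc n} = true ∷ full

Connected : ∀ {n} → Graph n → Set
Connected G = ConnectedIn G full

IsComponent : ∀ {n} → Graph n → Subset n → Subset n → Set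
IsComponent G X C =
  Nonempty C × C ⊆ X × ConnectedIn G C ×
  (∀ u v → u ∈ C → v ∈ X → Adj G u v → v ∈ C)

ConsecAdj : ∀ {n} → Graph n → List (Fin n) → Set
ConsecAdj G [] = Data.Unit.⊤ where import Data.Unit
ConsecAdj G (x ∷ []) = Data.Unit.⊤ where import Data.Unit
ConsecAdj G (x ∷ y ∷ xs) = Adj G x y × ConsecAdj G (y ∷ xs)

lastOr : ∀ {n} → Fin n → List (Fin n) → Fin n
lastOr d [] = d
lastOr d (x ∷ xs) = lastOr x xs

IsCycle : ∀ {n} → Graph n → List (Fin n) → Set
IsCycle G [] = ⊥
IsCycle G (x ∷ xs) =
  3 ≤ length (x ∷ xs) × Unique (x ∷ xs) × ConsecAdj G (x ∷ xs) × Adj G (lastOr x xs) x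

Acyclic : ∀ {n} → Graph n → Set
Acyclic G = ∀ c → IsCycle G c → ⊥

IsTree : ∀ {n} → Graph n → Set
IsTree {n} G = 1 ≤ n × Connected G × Acyclic G

DistLe : ∀ {n} → Graph n → ℕ → Fin n → Fin n → Set
DistLe G zero u v = u ≡ v
DistLe G (suc k) u v = u ≡ v ⊎ Σ _ (λ w → Adj G u w × DistLe G k w v)

-- double star: a tree of diameter at most three
IsDoubleStar : ∀ {n} → Graph n → Set
IsDoubleStar G = IsTree G × (∀ u v → DistLe G 3 u v)

Weight : ℕ → Set
Weight n = Fin n → ℚ

Positive : ∀ {n} → Weight n → Set
Positive w = ∀ v → 0ℚ <ℚ w v

wsum : ∀ {n} → Weight n → Subset n → ℚ
wsum w [] = 0ℚ
wsum w (b ∷ bs) = (if b then w zero else 0ℚ) + wsum (λ i → w (suc i)) bs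

IsSafe : ∀ {n} → Graph n → Weight n → Subset n → Set
IsSafe G w S =
  Nonempty S ×
  (∀ C D → IsComponent G S C → IsComponent G (∁ S) D →
     (∃[ u ] ∃[ v ] (u ∈ C × v ∈ D × Adj G u v)) →
     wsum w D ≤ℚ wsum w C)

IsConnSafe : ∀ {n} → Graph n → Weight n → Subset n → Set
IsConnSafe G w S = IsSafe G w S × ConnectedIn G S

IsMinOver : ∀ {n} → Weight n → (Subset n → Set) → ℚ → Set
IsMinOver w P m = (∃[ S ] (P S × wsum w S ≡ m)) × (∀ S → P S → m ≤ℚ wsum w S)

-- G ∈ 𝒢^cs : s(G,w) = cs(G,w) for every (positive, rational) weight function w
InGcs : ∀ {n} → Graph n → Set
InGcs G = ∀ w → Positive w → ∀ s cs →
  IsMinOver w (IsSafe G w) s → IsMinOver w (IsConnSafe G w) cs → s ≡ cs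

{-# OPTIONS --safe #-}
-- Double stars: a tree of diameter at most three has an edge ab such that every other vertex is a
-- leaf hanging at a or at b. Given a safe set S one builds a connected safe set that is no heavier.
-- If S contains a and b it is itself connected. If it contains neither, its heaviest vertex together
-- with a and b will do, since every vertex of S outweighs the component of the complement containing
-- a and b. If it contains a but not b, pick a leaf y at b in S: either y can be traded for b and a
-- minimal set of leaves at a outside S, or all those leaves together are lighter than y, and then b
-- with its leaves in S is a lighter connected safe set.
--
-- Other trees: a tree of diameter at least four contains a path p₀ p₁ p₂ p₃ p₄. Give these vertices
-- the weights 4n, 5n, 2n, 5n, 4n and every other vertex weight 1. Then {p₁, p₃} is safe of weight
-- 10n, while every connected safe set weighs more than 10n.
module Submission where

open import Defs hiding (sym)
open import Algebra.Bundles using (CommutativeMonoid)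
open import Data.Bool using (true; false; if_then_else_)
import Data.Bool.Properties as Bool
open import Data.Empty using (⊥; ⊥-elim)
open import Data.Fin using (Fin; zero; suc; _≟_)
open import Data.Fin.Properties using (any?; all?)
open import Data.Fin.Subset using (Subset; _∈_; _∉_; _⊆_; ∁; Nonempty; ⁅_⁆; _∪_; _∩_; _─_; _-_; ∣_∣)
  renaming (⊥ to ∅)
open import Data.Fin.Subset.Properties
  using (_∈?_; _⊆?_; ⊆-refl; nonempty?; anySubset?; drop-∷-⊆; p─⊥≡p; p─q⊆p; x∈p∧x≢y⇒x∈p-y; x∈p∧x∉q⇒x∈p─q;
         x∈p∪q⁺; x∈p∪q⁻; x∈p∩q⁺; x∈⁅x⁆; x∈⁅y⁆⇒x≡y; x≢y⇒x∉⁅y⁆; x∉p⇒x∈∁p; x∈∁p⇒x∉p; x∈p⇒x∉∁p;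
         x∈p⇒∣p-x∣<∣p∣; ∣p∣≤n)
open import Data.List using (List; []; _∷_)
open import Data.List.Membership.Propositional using () renaming (_∈_ to _∈ₗ_)
open import Data.List.Relation.Binary.Pointwise using (Pointwise; []; _∷_)
open import Data.List.Relation.Unary.All as All using (All; []; _∷_)
open import Data.List.Relation.Unary.All.Properties using (¬Any⇒All¬)
open import Data.List.Relation.Unary.Any as Any using (here; there)
open import Data.List.Relation.Unary.Unique.Propositional using (Unique; []; _∷_)
open import Data.Nat as ℕ using (ℕ; zero; suc)
import Data.Nat.Properties as ℕ
open import Data.Nat.ListAction using (sum)
open import Data.Product using (_×_; _,_; proj₁; ∃; ∃-syntax)
open import Data.Rational using (ℚ; 0ℚ; 1ℚ; _+_; _≤_; _<_)
import Data.Rational.Properties as ℚ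
open import Data.Sum using (_⊎_; inj₁; inj₂)
open import Data.Unit using (tt)
open import Data.Vec using ([]; _∷_; tabulate; here; there)
open import Data.Vec.Functional using (updateAt)
open import Data.Vec.Functional.Properties using (updateAt-updates; updateAt-minimal)
open import Data.Vec.Properties using (lookup∘tabulate; []=⇒lookup; lookup⇒[]=)
open import Function using (_∘_)
open import Function.Bundles using (_⇔_; mk⇔)
open import Relation.Binary.PropositionalEquality
  using (_≡_; _≢_; refl; sym; trans; cong; cong₂; subst; subst₂)
open import Relation.Nullary using (¬_; Dec; yes; no; does)
open import Relation.Nullary.Decidable
  using (_×-dec_; _⊎-dec_; _→-dec_; ¬?; map′; dec-true; decidable-stable; from-yes)
open import Relation.Unary using (Decidable)
open import Algebra.Properties.CommutativeSemigroup
  (CommutativeMonoid.commutativeSemigroup ℚ.+-0-commutativeMonoid) using (interchange; x∙yz≈y∙xz)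

-- Weights of vertex sets

NonNegative : ∀ {n} → Weight n → Set
NonNegative w = ∀ v → 0ℚ ≤ w v

positive⇒nonNegative : ∀ {n} {w : Weight n} → Positive w → NonNegative w
positive⇒nonNegative pos v = ℚ.<⇒≤ (pos v)

0<1 : 0ℚ < 1ℚ
0<1 = ℚ.positive⁻¹ 1ℚ

0≤1 : 0ℚ ≤ 1ℚ
0≤1 = ℚ.<⇒≤ 0<1

p≤p+q : ∀ {p q} → 0ℚ ≤ q → p ≤ p + q
p≤p+q {p} 0≤q = subst (_≤ p + _) (ℚ.+-identityʳ p) (ℚ.+-monoʳ-≤ p 0≤q)

fromℕ : ℕ → ℚ
fromℕ zero    = 0ℚ
fromℕ (suc k) = 1ℚ + fromℕ k

fromℕ-+ : ∀ a b → fromℕ (a ℕ.+ b) ≡ fromℕ a + fromℕ b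
fromℕ-+ zero    b = sym (ℚ.+-identityˡ (fromℕ b))
fromℕ-+ (suc a) b = trans (cong (1ℚ +_) (fromℕ-+ a b)) (sym (ℚ.+-assoc 1ℚ (fromℕ a) (fromℕ b)))

fromℕ-nonNegative : ∀ a → 0ℚ ≤ fromℕ a
fromℕ-nonNegative zero    = ℚ.≤-refl
fromℕ-nonNegative (suc a) = ℚ.+-mono-≤ 0≤1 (fromℕ-nonNegative a)

fromℕ-mono-< : ∀ {a b} → a ℕ.< b → fromℕ a < fromℕ b
fromℕ-mono-< {zero}  {suc b} _ = ℚ.+-mono-<-≤ 0<1 (fromℕ-nonNegative b)
fromℕ-mono-< {suc a} {suc b} (ℕ.s≤s a<b) = ℚ.+-monoʳ-< 1ℚ (fromℕ-mono-< a<b)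

x∈p─q⇒x∉q : ∀ {n} {x : Fin n} {p q} → x ∈ p ─ q → x ∉ q
x∈p─q⇒x∉q {x = zero}  {_ ∷ p} {true ∷ q}  ()
x∈p─q⇒x∉q {x = zero}  {_ ∷ p} {false ∷ q} _             ()
x∈p─q⇒x∉q {x = suc x} {_ ∷ p} {_ ∷ q}     (there x∈p─q) (there x∈q) = x∈p─q⇒x∉q x∈p─q x∈q

wsumList : ∀ {n} → Weight n → List (Fin n) → ℚ
wsumList w []       = 0ℚ
wsumList w (x ∷ xs) = w x + wsumList w xs

wsum-∅ : ∀ {n} (w : Weight n) → wsum w ∅ ≡ 0ℚ
wsum-∅ {zero}  w = refl
wsum-∅ {suc n} w = trans (ℚ.+-identityˡ _) (wsum-∅ (w ∘ suc))

wsum-⁅⁆ : ∀ {n} (w : Weight n) x → wsum w ⁅ x ⁆ ≡ w x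
wsum-⁅⁆ w zero    = trans (cong (w zero +_) (wsum-∅ (w ∘ suc))) (ℚ.+-identityʳ (w zero))
wsum-⁅⁆ w (suc x) = trans (ℚ.+-identityˡ _) (wsum-⁅⁆ (w ∘ suc) x)

wsum-split : ∀ {n} (w : Weight n) {x X} → x ∈ X → wsum w X ≡ w x + wsum w (X - x)
wsum-split w {zero} {true ∷ X} here =
  cong (w zero +_) (sym (trans (ℚ.+-identityˡ _) (cong (wsum (w ∘ suc)) (p─⊥≡p X))))
wsum-split w {suc x} {b ∷ X} (there x∈X) =
  trans (cong (c +_) (wsum-split (w ∘ suc) x∈X)) (x∙yz≈y∙xz c (w (suc x)) (wsum (w ∘ suc) (X - x)))
  where
  c : ℚ
  c = if b then w zero else 0ℚ

─∩-step : ∀ {n} (w : Weight (suc n)) X Y a b {c} → a + b ≡ c →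
          (a + wsum (w ∘ suc) (X ─ Y)) + (b + wsum (w ∘ suc) (X ∩ Y)) ≡ c + wsum (w ∘ suc) X

wsum-─∩ : ∀ {n} (w : Weight n) X Y → wsum w (X ─ Y) + wsum w (X ∩ Y) ≡ wsum w X
wsum-─∩ w []          []          = ℚ.+-identityˡ 0ℚ
wsum-─∩ w (true ∷ X)  (true ∷ Y)  = ─∩-step w X Y 0ℚ (w zero) (ℚ.+-identityˡ (w zero))
wsum-─∩ w (true ∷ X)  (false ∷ Y) = ─∩-step w X Y (w zero) 0ℚ (ℚ.+-identityʳ (w zero))
wsum-─∩ w (false ∷ X) (true ∷ Y)  = ─∩-step w X Y 0ℚ 0ℚ (ℚ.+-identityˡ 0ℚ)
wsum-─∩ w (false ∷ X) (false ∷ Y) = ─∩-step w X Y 0ℚ 0ℚ (ℚ.+-identityˡ 0ℚ)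

─∩-step w X Y a b a+b≡c =
  trans (interchange a _ b _) (cong₂ _+_ a+b≡c (wsum-─∩ (w ∘ suc) X Y))

wsum-mono : ∀ {n} {w : Weight n} → NonNegative w → ∀ {X Y} → X ⊆ Y → wsum w X ≤ wsum w Y
wsum-mono _ {[]} {[]} _ = ℚ.≤-refl
wsum-mono {w = w} w≥0 {true ∷ X}  {true ∷ Y}  X⊆Y =
  ℚ.+-monoʳ-≤ (w zero) (wsum-mono (w≥0 ∘ suc) (drop-∷-⊆ X⊆Y))
wsum-mono         w≥0 {true ∷ X}  {false ∷ Y} X⊆Y with X⊆Y here
... | ()
wsum-mono         w≥0 {false ∷ X} {true ∷ Y}  X⊆Y =
  ℚ.+-mono-≤ (w≥0 zero) (wsum-mono (w≥0 ∘ suc) (drop-∷-⊆ X⊆Y))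
wsum-mono         w≥0 {false ∷ X} {false ∷ Y} X⊆Y =
  ℚ.+-monoʳ-≤ 0ℚ (wsum-mono (w≥0 ∘ suc) (drop-∷-⊆ X⊆Y))

wsum-nonNegative : ∀ {n} {w : Weight n} → NonNegative w → ∀ X → 0ℚ ≤ wsum w X
wsum-nonNegative w≥0 []          = ℚ.≤-refl
wsum-nonNegative w≥0 (true ∷ X)  = ℚ.+-mono-≤ (w≥0 zero) (wsum-nonNegative (w≥0 ∘ suc) X)
wsum-nonNegative w≥0 (false ∷ X) = ℚ.+-mono-≤ ℚ.≤-refl (wsum-nonNegative (w≥0 ∘ suc) X)

w≤wsum : ∀ {n} {w : Weight n} → NonNegative w → ∀ {x X} → x ∈ X → w x ≤ wsum w X
w≤wsum {w = w} w≥0 {X = X} x∈X =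
  subst (w _ ≤_) (sym (wsum-split w x∈X)) (p≤p+q (wsum-nonNegative w≥0 (X - _)))

∪-step : ∀ {n} {w : Weight (suc n)} → NonNegative w → ∀ X Y a b {c} → c ≤ a + b →
         c + wsum (w ∘ suc) (X ∪ Y) ≤ (a + wsum (w ∘ suc) X) + (b + wsum (w ∘ suc) Y)

wsum-∪ : ∀ {n} {w : Weight n} → NonNegative w → ∀ X Y → wsum w (X ∪ Y) ≤ wsum w X + wsum w Y
wsum-∪         w≥0 []          []          = ℚ.≤-refl
wsum-∪ {w = w} w≥0 (true ∷ X)  (true ∷ Y)  = ∪-step w≥0 X Y (w zero) (w zero) (p≤p+q {w zero} (w≥0 zero))
wsum-∪ {w = w} w≥0 (true ∷ X)  (false ∷ Y) =
  ∪-step w≥0 X Y (w zero) 0ℚ (ℚ.≤-reflexive (sym (ℚ.+-identityʳ (w zero))))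
wsum-∪ {w = w} w≥0 (false ∷ X) (true ∷ Y)  =
  ∪-step w≥0 X Y 0ℚ (w zero) (ℚ.≤-reflexive (sym (ℚ.+-identityˡ (w zero))))
wsum-∪         w≥0 (false ∷ X) (false ∷ Y) = ∪-step w≥0 X Y 0ℚ 0ℚ ℚ.≤-refl

∪-step {w = w} w≥0 X Y a b c≤a+b =
  ℚ.≤-trans (ℚ.+-mono-≤ c≤a+b (wsum-∪ (w≥0 ∘ suc) X Y)) (ℚ.≤-reflexive (interchange a b _ _))

wsum-⁅⁆∪ : ∀ {n} {w : Weight n} → NonNegative w → ∀ x X → wsum w (⁅ x ⁆ ∪ X) ≤ w x + wsum w X
wsum-⁅⁆∪ {w = w} w≥0 x X = subst (λ q → wsum w (⁅ x ⁆ ∪ X) ≤ q + wsum w X) (wsum-⁅⁆ w x) (wsum-∪ w≥0 ⁅ x ⁆ X)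

wsum-distinct : ∀ {n} {w : Weight n} → NonNegative w → ∀ {X xs} →
                Unique xs → All (_∈ X) xs → wsumList w xs ≤ wsum w X
wsum-distinct w≥0 {X} []           []           = wsum-nonNegative w≥0 X
wsum-distinct {w = w} w≥0 {X} {x ∷ xs} (x∉xs ∷ xs!) (x∈X ∷ xs⊆X) =
  ℚ.≤-trans (ℚ.+-monoʳ-≤ (w x) (wsum-distinct w≥0 xs! xs⊆X-x)) (ℚ.≤-reflexive (sym (wsum-split w x∈X)))
  where
  xs⊆X-x : All (_∈ X - x) xs
  xs⊆X-x = All.zipWith (λ (y∈X , x≢y) → x∈p∧x≢y⇒x∈p-y y∈X (x≢y ∘ sym)) (xs⊆X , x∉xs)

wsum-light : ∀ {n} {w : Weight n} X → (∀ {v} → v ∈ X → w v ≤ 1ℚ) → wsum w X ≤ fromℕ n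
wsum-light []          _     = ℚ.≤-refl
wsum-light (true ∷ X)  light = ℚ.+-mono-≤ (light here) (wsum-light X (light ∘ there))
wsum-light (false ∷ X) light = ℚ.+-mono-≤ 0≤1 (wsum-light X (light ∘ there))

wsum-cover : ∀ {n} {w : Weight n} → NonNegative w → ∀ {X} xs → (∀ {v} → v ∈ X → v ∈ₗ xs ⊎ w v ≤ 1ℚ) →
             wsum w X ≤ wsumList w xs + fromℕ n
wsum-cover {w = w} w≥0 {X} [] cover =
  subst (wsum w X ≤_) (sym (ℚ.+-identityˡ _)) (wsum-light X (λ v∈X → light (cover v∈X)))
  where
  light : ∀ {v} → v ∈ₗ [] ⊎ w v ≤ 1ℚ → w v ≤ 1ℚ
  light (inj₂ wv≤1) = wv≤1
wsum-cover {n} {w} w≥0 {X} (x ∷ xs) cover = begin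
  wsum w X                          ≤⟨ wsum-mono w≥0 X⊆x∪X-x ⟩
  wsum w (⁅ x ⁆ ∪ (X - x))          ≤⟨ wsum-⁅⁆∪ w≥0 x (X - x) ⟩
  w x + wsum w (X - x)              ≤⟨ ℚ.+-monoʳ-≤ (w x) (wsum-cover w≥0 xs cover′) ⟩
  w x + (wsumList w xs + fromℕ n)   ≡⟨ sym (ℚ.+-assoc (w x) _ _) ⟩
  wsumList w (x ∷ xs) + fromℕ n     ∎
  where
  open ℚ.≤-Reasoning
  X⊆x∪X-x : X ⊆ ⁅ x ⁆ ∪ (X - x)
  X⊆x∪X-x {v} v∈X with v ≟ x
  ... | yes refl = x∈p∪q⁺ (inj₁ (x∈⁅x⁆ x))
  ... | no  v≢x  = x∈p∪q⁺ (inj₂ (x∈p∧x≢y⇒x∈p-y v∈X v≢x))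
  cover′ : ∀ {v} → v ∈ X - x → v ∈ₗ xs ⊎ w v ≤ 1ℚ
  cover′ {v} v∈X-x with cover (p─q⊆p X ⁅ x ⁆ v∈X-x)
  ... | inj₁ (here refl)  = ⊥-elim (x∈p─q⇒x∉q v∈X-x (x∈⁅x⁆ x))
  ... | inj₁ (there v∈xs) = inj₁ v∈xs
  ... | inj₂ wv≤1         = inj₂ wv≤1

wsum-pair : ∀ {n} {w : Weight n} → NonNegative w → ∀ {x y X} → x ≢ y → x ∈ X → y ∈ X → w x + w y ≤ wsum w X
wsum-pair {w = w} w≥0 x≢y x∈X y∈X =
  subst (w _ + w _ ≤_) (sym (wsum-split w x∈X)) (ℚ.+-monoʳ-≤ (w _) (w≤wsum w≥0 (x∈p∧x≢y⇒x∈p-y y∈X (x≢y ∘ sym))))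

wsum-remove-< : ∀ {n} {w : Weight n} → Positive w → ∀ {x X} → x ∈ X → wsum w (X - x) < wsum w X
wsum-remove-< {w = w} w>0 {x} {X} x∈X =
  subst₂ _<_ (ℚ.+-identityˡ _) (sym (wsum-split w x∈X)) (ℚ.+-monoˡ-< (wsum w (X - x)) (w>0 x))

-- Walks, components and safe sets

subset : ∀ {n} {P : Fin n → Set} → Decidable P → Subset n
subset P? = tabulate (does ∘ P?)

module _ {n} {P : Fin n → Set} (P? : Decidable P) where

  ∈subset⁺ : ∀ {x} → P x → x ∈ subset P?
  ∈subset⁺ {x} p = lookup⇒[]= x (subset P?) (trans (lookup∘tabulate (does ∘ P?) x) (dec-true (P? x) p))

  ∈subset⁻ : ∀ {x} → x ∈ subset P? → P x
  ∈subset⁻ {x} x∈P with P? x | trans (sym (lookup∘tabulate (does ∘ P?) x)) ([]=⇒lookup x∈P)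
  ... | yes p | _ = p
  ... | no  _ | ()

module _ {n} (G : Graph n) where

  Adj-sym : ∀ {u v} → Adj G u v → Adj G v u
  Adj-sym {u} {v} u~v = trans (Graph.sym G v u) u~v

  Adj⇒≢ : ∀ {u v} → Adj G u v → u ≢ v
  Adj⇒≢ {u} u~u refl with trans (sym u~u) (Graph.irrefl G u)
  ... | ()

  Adj? : ∀ u v → Dec (Adj G u v)
  Adj? u v = adj G u v Bool.≟ true

  neighbours : Fin n → Subset n
  neighbours u = subset (Adj? u)

  reach-source : ∀ {X u v} → Reach G X u v → u ∈ X
  reach-source (here u∈X)     = u∈X
  reach-source (step walk _ _) = reach-source walk

  reach-target : ∀ {X u v} → Reach G X u v → v ∈ X
  reach-target (here v∈X)     = v∈X
  reach-target (step _ _ v∈X) = v∈X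

  reach-mono : ∀ {X Y u v} → X ⊆ Y → Reach G X u v → Reach G Y u v
  reach-mono X⊆Y (here u∈X)        = here (X⊆Y u∈X)
  reach-mono X⊆Y (step walk v~w w∈X) = step (reach-mono X⊆Y walk) v~w (X⊆Y w∈X)

  reach-trans : ∀ {X u v w} → Reach G X u v → Reach G X v w → Reach G X u w
  reach-trans walk (here _)           = walk
  reach-trans walk (step walk′ v~w w∈X) = step (reach-trans walk walk′) v~w w∈X

  reach-edge : ∀ {X u v} → u ∈ X → Adj G u v → v ∈ X → Reach G X u v
  reach-edge u∈X u~v v∈X = step (here u∈X) u~v v∈X

  reach-sym : ∀ {X u v} → Reach G X u v → Reach G X v u
  reach-sym (here u∈X)          = here u∈X
  reach-sym (step walk v~w w∈X) = reach-trans (reach-edge w∈X (Adj-sym v~w) (reach-target walk)) (reach-sym walk)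

  reach-first-step : ∀ {X u v} → Reach G X u v →
                     u ≡ v ⊎ ∃[ u′ ] (Adj G u u′ × u′ ∈ X × Reach G (X - u) u′ v)
  reach-first-step (here _) = inj₁ refl
  reach-first-step {u = u} (step {w = w} walk v~w w∈X) with w ≟ u
  ... | yes w≡u = inj₁ (sym w≡u)
  ... | no  w≢u with reach-first-step walk
  ...   | inj₁ refl = inj₂ (w , v~w , w∈X , here (x∈p∧x≢y⇒x∈p-y w∈X w≢u))
  ...   | inj₂ (u′ , u~u′ , u′∈X , walk′) =
    inj₂ (u′ , u~u′ , u′∈X , step walk′ v~w (x∈p∧x≢y⇒x∈p-y w∈X w≢u))

  private
    reach?-by-size : ∀ k X → ∣ X ∣ ℕ.< k → ∀ u v → Dec (Reach G X u v)
    reach?-by-size zero    X ()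
    reach?-by-size (suc k) X ∣X∣<k u v with u ∈? X | u ≟ v
    ... | no  u∉X | _        = no (u∉X ∘ reach-source)
    ... | yes u∈X | yes refl = yes (here u∈X)
    ... | yes u∈X | no  u≢v  =
      map′ from to (any? (λ u′ → Adj? u u′ ×-dec u′ ∈? X ×-dec reach?-by-size k (X - u) ∣X-u∣<k u′ v))
      where
      ∣X-u∣<k : ∣ X - u ∣ ℕ.< k
      ∣X-u∣<k = ℕ.<-≤-trans (x∈p⇒∣p-x∣<∣p∣ u∈X) (ℕ.≤-pred ∣X∣<k)
      from : ∃[ u′ ] (Adj G u u′ × u′ ∈ X × Reach G (X - u) u′ v) → Reach G X u v
      from (u′ , u~u′ , u′∈X , walk) = reach-trans (reach-edge u∈X u~u′ u′∈X) (reach-mono (p─q⊆p X ⁅ u ⁆) walk)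
      to : Reach G X u v → ∃[ u′ ] (Adj G u u′ × u′ ∈ X × Reach G (X - u) u′ v)
      to walk with reach-first-step walk
      ... | inj₁ u≡v = ⊥-elim (u≢v u≡v)
      ... | inj₂ rerouted = rerouted

  reach? : ∀ X u v → Dec (Reach G X u v)
  reach? X = reach?-by-size (suc n) X (ℕ.s≤s (∣p∣≤n X))

  opaque
    component : Subset n → Fin n → Subset n
    component X x = subset (reach? X x)

    ∈component⁺ : ∀ {X x y} → Reach G X x y → y ∈ component X x
    ∈component⁺ {X} {x} = ∈subset⁺ (reach? X x)

    ∈component⁻ : ∀ {X x y} → y ∈ component X x → Reach G X x y
    ∈component⁻ {X} {x} = ∈subset⁻ (reach? X x)

  x∈component : ∀ {X x} → x ∈ X → x ∈ component X x
  x∈component x∈X = ∈component⁺ (here x∈X)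

  component⊆ : ∀ {X x} → component X x ⊆ X
  component⊆ = reach-target ∘ ∈component⁻

  component-isComponent : ∀ {X x} → x ∈ X → IsComponent G X (component X x)
  component-isComponent {X} {x} x∈X =
    (x , x∈component x∈X) ,
    component⊆  ,
    (λ u v u∈C v∈C → reach-trans (reach-sym (walk-in-component (∈component⁻ u∈C)))
                                 (walk-in-component (∈component⁻ v∈C))) ,
    (λ u v u∈C v∈X u~v → ∈component⁺ (step (∈component⁻ u∈C) u~v v∈X))
    where
    walk-in-component : ∀ {u} → Reach G X x u → Reach G (component X x) x u
    walk-in-component (here x∈X)          = here (x∈component x∈X)
    walk-in-component (step walk v~w w∈X) =
      step (walk-in-component walk) v~w (∈component⁺ (step walk v~w w∈X))

  isComponent-closed : ∀ {X C x y} → IsComponent G X C → x ∈ C → Reach G X x y → y ∈ C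
  isComponent-closed C-comp x∈C (here _)                = x∈C
  isComponent-closed C-comp@(_ , _ , _ , closed) x∈C (step walk v~w w∈X) =
    closed _ _ (isComponent-closed C-comp x∈C walk) w∈X v~w

  isComponent⊆component : ∀ {X C x} → IsComponent G X C → x ∈ C → C ⊆ component X x
  isComponent⊆component {x = x} (_ , C⊆X , C-conn , _) x∈C y∈C =
    ∈component⁺ (reach-mono C⊆X (C-conn x _ x∈C y∈C))

  connected⊆isComponent : ∀ {X C} → ConnectedIn G X → IsComponent G X C → X ⊆ C
  connected⊆isComponent X-conn C-comp@((c , c∈C) , C⊆X , _) y∈X =
    isComponent-closed C-comp c∈C (X-conn _ _ (C⊆X c∈C) y∈X)

  component-of-isolated : ∀ {X v} → (∀ u → Adj G v u → u ∉ X) → component X v ⊆ ⁅ v ⁆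
  component-of-isolated {X} {v} isolated y∈C = subst (_∈ ⁅ v ⁆) (stays (∈component⁻ y∈C)) (x∈⁅x⁆ v)
    where
    stays : ∀ {y} → Reach G X v y → v ≡ y
    stays (here _) = refl
    stays (step walk u~y y∈X) with stays walk
    ... | refl = ⊥-elim (isolated _ u~y y∈X)

allSubsets? : ∀ {n} {P : Subset n → Set} → (∀ S → Dec (P S)) → Dec (∀ S → P S)
allSubsets? P? with anySubset? (¬? ∘ P?)
... | yes (S , ¬PS) = no λ ∀P → ¬PS (∀P S)
... | no  ¬∃¬P      = yes λ S → decidable-stable (P? S) (λ ¬PS → ¬∃¬P (S , ¬PS))

Minimum : ∀ {n} → (Subset n → Set) → (Subset n → ℚ) → Set
Minimum P f = ∃[ S ] (P S × ∀ S′ → P S′ → f S ≤ f S′)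

minimum? : ∀ {n} {P : Subset n → Set} → (∀ S → Dec (P S)) → ∀ f → Minimum P f ⊎ ¬ ∃ P
minimum? {zero} P? f with P? []
... | yes p  = inj₁ ([] , p , λ { [] _ → ℚ.≤-refl })
minimum? {zero} P? f | no ¬p = inj₂ λ { ([] , p) → ¬p p }
minimum? {suc n} {P} P? f =
  merge (minimum? (P? ∘ (true ∷_)) (f ∘ (true ∷_))) (minimum? (P? ∘ (false ∷_)) (f ∘ (false ∷_)))
  where
  merge : Minimum (P ∘ (true ∷_)) (f ∘ (true ∷_)) ⊎ ¬ ∃ (P ∘ (true ∷_)) →
          Minimum (P ∘ (false ∷_)) (f ∘ (false ∷_)) ⊎ ¬ ∃ (P ∘ (false ∷_)) →
          Minimum P f ⊎ ¬ ∃ P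
  merge (inj₂ ¬∃₁) (inj₂ ¬∃₀) = inj₂ λ { (true ∷ S , p) → ¬∃₁ (S , p) ; (false ∷ S , p) → ¬∃₀ (S , p) }
  merge (inj₁ (S₁ , p₁ , min₁)) (inj₂ ¬∃₀) =
    inj₁ (true ∷ S₁ , p₁ , λ { (true ∷ S) p → min₁ S p ; (false ∷ S) p → ⊥-elim (¬∃₀ (S , p)) })
  merge (inj₂ ¬∃₁) (inj₁ (S₀ , p₀ , min₀)) =
    inj₁ (false ∷ S₀ , p₀ , λ { (true ∷ S) p → ⊥-elim (¬∃₁ (S , p)) ; (false ∷ S) p → min₀ S p })
  merge (inj₁ (S₁ , p₁ , min₁)) (inj₁ (S₀ , p₀ , min₀)) with ℚ.≤-total (f (true ∷ S₁)) (f (false ∷ S₀))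
  ... | inj₁ ≤₀ = inj₁ (true ∷ S₁ , p₁ , λ { (true ∷ S) p → min₁ S p ; (false ∷ S) p → ℚ.≤-trans ≤₀ (min₀ S p) })
  ... | inj₂ ≤₁ = inj₁ (false ∷ S₀ , p₀ , λ { (true ∷ S) p → ℚ.≤-trans ≤₁ (min₁ S p) ; (false ∷ S) p → min₀ S p })

minimum : ∀ {n} {P : Subset n → Set} → (∀ S → Dec (P S)) → ∀ f → ∃ P → Minimum P f
minimum P? f ∃P with minimum? P? f
... | inj₁ min = min
... | inj₂ ¬∃P = ⊥-elim (¬∃P ∃P)

argmax : ∀ {n} (f : Fin n → ℚ) {X : Subset n} → Nonempty X → ∃[ l ] (l ∈ X × ∀ {x} → x ∈ X → f x ≤ f l)
argmax f {true ∷ X} _ with nonempty? X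
... | no X≡∅ = zero , here , λ { here → ℚ.≤-refl ; (there x∈X) → ⊥-elim (X≡∅ (_ , x∈X)) }
... | yes X≢∅ with argmax (f ∘ suc) X≢∅
...   | l , l∈X , f≤fl with ℚ.≤-total (f zero) (f (suc l))
...     | inj₁ f0≤fl = suc l , there l∈X , λ { here → f0≤fl ; (there x∈X) → f≤fl x∈X }
...     | inj₂ fl≤f0 = zero , here , λ { here → ℚ.≤-refl ; (there x∈X) → ℚ.≤-trans (f≤fl x∈X) fl≤f0 }
argmax f {false ∷ X} (suc x , there x∈X) with argmax (f ∘ suc) (x , x∈X)
... | l , l∈X , f≤fl = suc l , there l∈X , λ { (there x∈X) → f≤fl x∈X }

∈full : ∀ {n} {x : Fin n} → x ∈ full
∈full {x = zero}  = here
∈full {x = suc x} = there ∈full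

module _ {n} (G : Graph n) where

  connectedIn? : ∀ X → Dec (ConnectedIn G X)
  connectedIn? X = all? λ u → all? λ v → u ∈? X →-dec (v ∈? X →-dec reach? G X u v)

  isComponent? : ∀ X C → Dec (IsComponent G X C)
  isComponent? X C = nonempty? C ×-dec C ⊆? X ×-dec connectedIn? C ×-dec
    (all? λ u → all? λ v → u ∈? C →-dec (v ∈? X →-dec (Adj? G u v →-dec v ∈? C)))

  adjacent? : ∀ C D → Dec (∃[ u ] ∃[ v ] (u ∈ C × v ∈ D × Adj G u v))
  adjacent? C D = any? λ u → any? λ v → u ∈? C ×-dec v ∈? D ×-dec Adj? G u v

  isSafe? : ∀ w S → Dec (IsSafe G w S)
  isSafe? w S = nonempty? S ×-dec (allSubsets? λ C → allSubsets? λ D →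
    isComponent? S C →-dec (isComponent? (∁ S) D →-dec (adjacent? C D →-dec wsum w D ℚ.≤? wsum w C)))

  isConnSafe? : ∀ w S → Dec (IsConnSafe G w S)
  isConnSafe? w S = isSafe? w S ×-dec connectedIn? S

  module _ {w : Weight n} (w≥0 : NonNegative w) where

    isolated⇒component≤ : ∀ {X v} → (∀ u → Adj G v u → u ∉ X) → wsum w (component G X v) ≤ w v
    isolated⇒component≤ {v = v} isolated =
      subst (wsum w (component G _ v) ≤_) (wsum-⁅⁆ w v) (wsum-mono w≥0 (component-of-isolated G isolated))

    safe⇒component≤component : ∀ {S x v x′ v′} → IsSafe G w S → x ∈ S → v ∉ S →
      x′ ∈ component G S x → v′ ∈ component G (∁ S) v → Adj G x′ v′ →
      wsum w (component G (∁ S) v) ≤ wsum w (component G S x)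
    safe⇒component≤component (_ , safe) x∈S v∉S x′∈C v′∈D x′~v′ =
      safe _ _ (component-isComponent G x∈S) (component-isComponent G (x∉p⇒x∈∁p v∉S)) (_ , _ , x′∈C , v′∈D , x′~v′)

    -- The first vertex of S on a walk from v is adjacent to the component of ∁ S containing v.
    safe⇒∁component≤ : Connected G → ∀ {S v} → IsSafe G w S → v ∉ S →
                       wsum w (component G (∁ S) v) ≤ wsum w S
    safe⇒∁component≤ G-conn {S} {v} S-safe@((s , s∈S) , _) v∉S = bound (exit (G-conn v s ∈full ∈full))
      where
      Edge : Set
      Edge = ∃[ x ] ∃[ y ] (x ∈ S × y ∈ component G (∁ S) v × Adj G y x)
      exit : ∀ {u} → Reach G full v u → Edge ⊎ u ∈ component G (∁ S) v
      exit (here _) = inj₂ (x∈component G (x∉p⇒x∈∁p v∉S))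
      exit (step {w = u} walk t~u _) with exit walk | u ∈? S
      ... | inj₁ edge | _        = inj₁ edge
      ... | inj₂ t∈D  | yes u∈S = inj₁ (u , _ , u∈S , t∈D , t~u)
      ... | inj₂ t∈D  | no  u∉S = inj₂ (∈component⁺ G (step (∈component⁻ G t∈D) t~u (x∉p⇒x∈∁p u∉S)))
      bound : Edge ⊎ s ∈ component G (∁ S) v → wsum w (component G (∁ S) v) ≤ wsum w S
      bound (inj₁ (x , y , x∈S , y∈D , y~x)) =
        ℚ.≤-trans (safe⇒component≤component S-safe x∈S v∉S (x∈component G x∈S) y∈D (Adj-sym G y~x))
                  (wsum-mono w≥0 (component⊆ G))
      bound (inj₂ s∈D) = ⊥-elim (x∈∁p⇒x∉p (component⊆ G s∈D) s∈S)

    connSafe-intro : ∀ {S} → Nonempty S → ConnectedIn G S →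
                     (∀ {v} → v ∉ S → wsum w (component G (∁ S) v) ≤ wsum w S) → IsConnSafe G w S
    connSafe-intro {S} S≢∅ S-conn ∁components≤ = (S≢∅ , bound) , S-conn
      where
      bound : ∀ C D → IsComponent G S C → IsComponent G (∁ S) D →
              ∃[ u ] ∃[ v ] (u ∈ C × v ∈ D × Adj G u v) → wsum w D ≤ wsum w C
      bound C D C-comp D-comp@((v , v∈D) , D⊆∁S , _) _ = begin
        wsum w D                        ≤⟨ wsum-mono w≥0 (isComponent⊆component G D-comp v∈D) ⟩
        wsum w (component G (∁ S) v)    ≤⟨ ∁components≤ (x∈∁p⇒x∉p (D⊆∁S v∈D)) ⟩
        wsum w S                        ≤⟨ wsum-mono w≥0 (connected⊆isComponent G S-conn C-comp) ⟩
        wsum w C                        ∎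
        where open ℚ.≤-Reasoning

    full-isConnSafe : Connected G → Fin n → IsConnSafe G w full
    full-isConnSafe G-conn x = connSafe-intro (x , ∈full) G-conn (λ v∉full → ⊥-elim (v∉full ∈full))

  LighterConnSafe : Weight n → Subset n → Set
  LighterConnSafe w S = ∃[ S′ ] (IsConnSafe G w S′ × wsum w S′ ≤ wsum w S)

  InGcs-intro : (∀ w → Positive w → ∀ S → IsSafe G w S → LighterConnSafe w S) → InGcs G
  InGcs-intro lighter w w>0 _ _ ((S , S-safe , refl) , s-min) ((C , C-connSafe , refl) , cs-min)
    with lighter w w>0 S S-safe
  ... | S′ , S′-connSafe , S′≤S =
    ℚ.≤-antisym (s-min C (proj₁ C-connSafe)) (ℚ.≤-trans (cs-min S′ S′-connSafe) S′≤S)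

  ¬InGcs-intro : Connected G → ∀ w → Positive w → ∀ S → IsSafe G w S →
                 (∀ S′ → IsConnSafe G w S′ → wsum w S < wsum w S′) → ¬ InGcs G
  ¬InGcs-intro G-conn w w>0 S S-safe gap inGcs with
    minimum (isSafe? w) (wsum w) (S , S-safe) |
    minimum (isConnSafe? w) (wsum w) (full , full-isConnSafe (positive⇒nonNegative w>0) G-conn (proj₁ (proj₁ S-safe)))
  ... | S₀ , S₀-safe , s-min | C₀ , C₀-connSafe , cs-min =
    ℚ.<-irrefl (inGcs w w>0 _ _ ((S₀ , S₀-safe , refl) , s-min) ((C₀ , C₀-connSafe , refl) , cs-min))
               (ℚ.≤-<-trans (s-min S S-safe) (gap C₀ C₀-connSafe))

-- Paths and dominating edges in trees

∈∁⁅⁆ : ∀ {n} {x y : Fin n} → x ≢ y → x ∈ ∁ ⁅ y ⁆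
∈∁⁅⁆ x≢y = x∉p⇒x∈∁p (x≢y⇒x∉⁅y⁆ x≢y)

∉∁⁅⁆ : ∀ {n} (x : Fin n) → x ∉ ∁ ⁅ x ⁆
∉∁⁅⁆ x = x∈p⇒x∉∁p (x∈⁅x⁆ x)

module _ {n} (G : Graph n) where

  -- A simple path in X between a and b, listed from b back to a.
  private
    record SimplePath (X : Subset n) (a b : Fin n) : Set where
      constructor simplePath
      field
        rest        : List (Fin n)
        unique      : Unique (b ∷ rest)
        consecutive : ConsecAdj G (b ∷ rest)
        ends        : lastOr b rest ≡ a
        inside      : All (_∈ X) (b ∷ rest)

    suffix : ∀ {X a b v} (p : SimplePath X a b) → v ∈ₗ b ∷ SimplePath.rest p → SimplePath X a v
    suffix p (here refl) = p
    suffix (simplePath (c ∷ rest) (_ ∷ unique) (_ , consecutive) ends (_ ∷ inside)) (there v∈rest) =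
      suffix (simplePath rest unique consecutive ends inside) v∈rest

    erase-loops : ∀ {X a b} → Reach G X a b → SimplePath X a b
    erase-loops (here a∈X) = simplePath [] ([] ∷ []) tt refl (a∈X ∷ [])
    erase-loops (step {v = v} {w = w} walk v~w w∈X) with erase-loops walk
    ... | p@(simplePath rest unique consecutive ends inside) with Any.any? (w ≟_) (v ∷ rest)
    ...   | yes w∈p = suffix p w∈p
    ...   | no  w∉p =
      simplePath (v ∷ rest) (¬Any⇒All¬ _ w∉p ∷ unique) (Adj-sym G v~w , consecutive) ends (w∈X ∷ inside)

  -- A simple path from a to b avoiding m closes a cycle with m.
  acyclic⇒no-detour : Acyclic G → ∀ {X a m b} → Adj G a m → Adj G m b → a ≢ b → m ∉ X → ¬ Reach G X a b
  acyclic⇒no-detour acyclic {X} {a} {m} {b} a~m m~b a≢b m∉X walk with erase-loops walk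
  ... | simplePath []       _      _           ends _      = a≢b (sym ends)
  ... | simplePath (c ∷ cs) unique consecutive ends inside =
    acyclic (m ∷ b ∷ c ∷ cs)
      ( ℕ.s≤s (ℕ.s≤s (ℕ.s≤s ℕ.z≤n))
      , All.map (λ v∈X m≡v → m∉X (subst (_∈ X) (sym m≡v) v∈X)) inside ∷ unique
      , (m~b , consecutive)
      , subst (λ z → Adj G z m) (sym ends) a~m )

  acyclic⇒triangle-free : Acyclic G → ∀ {x y z} → Adj G x y → Adj G y z → ¬ Adj G z x
  acyclic⇒triangle-free acyclic {y = y} x~y y~z z~x =
    acyclic⇒no-detour acyclic x~y y~z (Adj⇒≢ G (Adj-sym G z~x)) (∉∁⁅⁆ y)
      (reach-edge G (∈∁⁅⁆ (Adj⇒≢ G x~y)) (Adj-sym G z~x) (∈∁⁅⁆ (Adj⇒≢ G y~z ∘ sym)))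

  DistLe? : ∀ k u v → Dec (DistLe G k u v)
  DistLe? zero    u v = u ≟ v
  DistLe? (suc k) u v = u ≟ v ⊎-dec any? λ w → Adj? G u w ×-dec DistLe? k w v

  distLe-refl : ∀ k {x} → DistLe G k x x
  distLe-refl zero    = refl
  distLe-refl (suc k) = inj₁ refl

  distLe-step : ∀ {k u w v} → Adj G u w → DistLe G k w v → DistLe G (suc k) u v
  distLe-step u~w w→v = inj₂ (_ , u~w , w→v)

  avoid-or-near : ∀ k {z t c} → DistLe G (suc k) z t → t ≢ c → Reach G (∁ ⁅ c ⁆) z t ⊎ DistLe G k z c
  avoid-or-near k (inj₁ refl) t≢c = inj₁ (here (∈∁⁅⁆ t≢c))
  avoid-or-near k {z} {c = c} (inj₂ (w , z~w , w→t)) t≢c with z ≟ c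
  ... | yes refl = inj₂ (distLe-refl k)
  avoid-or-near zero    (inj₂ (w , z~w , refl)) t≢c | no z≢c = inj₁ (reach-edge G (∈∁⁅⁆ z≢c) z~w (∈∁⁅⁆ t≢c))
  avoid-or-near (suc k) (inj₂ (w , z~w , w→t)) t≢c | no z≢c with avoid-or-near k w→t t≢c
  ... | inj₁ walk = inj₁ (reach-trans G (reach-edge G (∈∁⁅⁆ z≢c) z~w (reach-source G walk)) walk)
  ... | inj₂ w→c  = inj₂ (distLe-step z~w w→c)

  record Path₅ : Set where
    field
      p₀ p₁ p₂ p₃ p₄ : Fin n
      p₀~p₁ : Adj G p₀ p₁
      p₁~p₂ : Adj G p₁ p₂
      p₂~p₃ : Adj G p₂ p₃
      p₃~p₄ : Adj G p₃ p₄
      p₀≢p₂ : p₀ ≢ p₂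
      p₀≢p₃ : p₀ ≢ p₃
      p₀≢p₄ : p₀ ≢ p₄
      p₁≢p₃ : p₁ ≢ p₃
      p₁≢p₄ : p₁ ≢ p₄
      p₂≢p₄ : p₂ ≢ p₄

    p₀≢p₁ : p₀ ≢ p₁
    p₀≢p₁ = Adj⇒≢ G p₀~p₁
    p₁≢p₂ : p₁ ≢ p₂
    p₁≢p₂ = Adj⇒≢ G p₁~p₂
    p₂≢p₃ : p₂ ≢ p₃
    p₂≢p₃ = Adj⇒≢ G p₂~p₃
    p₃≢p₄ : p₃ ≢ p₄
    p₃≢p₄ = Adj⇒≢ G p₃~p₄

  reverse : Path₅ → Path₅
  reverse P = record
    { p₀ = p₄ ; p₁ = p₃ ; p₂ = p₂ ; p₃ = p₁ ; p₄ = p₀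
    ; p₀~p₁ = Adj-sym G p₃~p₄ ; p₁~p₂ = Adj-sym G p₂~p₃ ; p₂~p₃ = Adj-sym G p₁~p₂ ; p₃~p₄ = Adj-sym G p₀~p₁
    ; p₀≢p₂ = p₂≢p₄ ∘ sym ; p₀≢p₃ = p₁≢p₄ ∘ sym ; p₀≢p₄ = p₀≢p₄ ∘ sym
    ; p₁≢p₃ = p₁≢p₃ ∘ sym ; p₁≢p₄ = p₀≢p₃ ∘ sym ; p₂≢p₄ = p₀≢p₂ ∘ sym }
    where open Path₅ P

  leave-ball : ∀ {u y z} → DistLe G 3 u y → Adj G y z → ¬ DistLe G 3 u z → Path₅
  leave-ball (inj₁ refl) y~z far = ⊥-elim (far (distLe-step y~z (distLe-refl 2)))
  leave-ball (inj₂ (q₁ , u~q₁ , inj₁ refl)) y~z far = ⊥-elim (far (distLe-step u~q₁ (distLe-step y~z (distLe-refl 1))))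
  leave-ball (inj₂ (q₁ , u~q₁ , inj₂ (q₂ , q₁~q₂ , inj₁ refl))) y~z far =
    ⊥-elim (far (distLe-step u~q₁ (distLe-step q₁~q₂ (distLe-step y~z refl))))
  leave-ball {u} {y} {z} (inj₂ (q₁ , u~q₁ , inj₂ (q₂ , q₁~q₂ , inj₂ (q₃ , q₂~y , refl)))) y~z far = record
    { p₀ = u ; p₁ = q₁ ; p₂ = q₂ ; p₃ = y ; p₄ = z
    ; p₀~p₁ = u~q₁ ; p₁~p₂ = q₁~q₂ ; p₂~p₃ = q₂~y ; p₃~p₄ = y~z
    ; p₀≢p₂ = λ { refl → far (distLe-step q₂~y (distLe-step y~z (distLe-refl 1))) }
    ; p₀≢p₃ = λ { refl → far (distLe-step y~z (distLe-refl 2)) }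
    ; p₀≢p₄ = λ { refl → far (distLe-refl 3) }
    ; p₁≢p₃ = λ { refl → far (distLe-step u~q₁ (distLe-step y~z (distLe-refl 1))) }
    ; p₁≢p₄ = λ { refl → far (distLe-step u~q₁ (distLe-refl 2)) }
    ; p₂≢p₄ = λ { refl → far (distLe-step u~q₁ (distLe-step q₁~q₂ (distLe-refl 1))) }
    }

  far⇒Path₅ : Connected G → ∀ {u v} → ¬ DistLe G 3 u v → Path₅
  far⇒Path₅ G-conn {u} {v} far = escape (G-conn u v ∈full ∈full) far
    where
    escape : ∀ {z} → Reach G full u z → ¬ DistLe G 3 u z → Path₅
    escape (here _) far = ⊥-elim (far (distLe-refl 3))
    escape (step {v = y} {w = z} walk y~z _) far with DistLe? 3 u y
    ... | yes near = leave-ball near y~z far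
    ... | no  far′ = escape walk far′

  record DominatingEdge : Set where
    field
      a b       : Fin n
      a~b       : Adj G a b
      dominates : ∀ z → z ≡ a ⊎ z ≡ b ⊎ Adj G a z ⊎ Adj G b z

  swap : DominatingEdge → DominatingEdge
  swap e = record { a = b ; b = a ; a~b = Adj-sym G a~b ; dominates = dominates′ }
    where
    open DominatingEdge e
    dominates′ : ∀ z → z ≡ b ⊎ z ≡ a ⊎ Adj G b z ⊎ Adj G a z
    dominates′ z with dominates z
    ... | inj₁ z≡a               = inj₂ (inj₁ z≡a)
    ... | inj₂ (inj₁ z≡b)        = inj₁ z≡b
    ... | inj₂ (inj₂ (inj₁ a~z)) = inj₂ (inj₂ (inj₂ a~z))
    ... | inj₂ (inj₂ (inj₂ b~z)) = inj₂ (inj₂ (inj₁ b~z))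

  module _ (acyclic : Acyclic G) (diam≤3 : ∀ x y → DistLe G 3 x y) where

    private
      -- On a geodesic u q₁ q₂ v, a vertex z outside N[q₁] cannot reach both u and v avoiding q₁.
      two-steps-to : ∀ {u q₁ q₂ v z} → Adj G u q₁ → Adj G q₁ q₂ → Adj G q₂ v → u ≢ q₂ → v ≢ q₁ →
                     z ≢ q₁ → ¬ Adj G q₁ z → ∃[ x ] (Adj G z x × Adj G x q₁)
      two-steps-to {u} {q₁} {q₂} {v} {z} u~q₁ q₁~q₂ q₂~v u≢q₂ v≢q₁ z≢q₁ q₁≁z = two-steps near
        where
        near : DistLe G 2 z q₁
        near with avoid-or-near 2 (diam≤3 z u) (Adj⇒≢ G u~q₁) | avoid-or-near 2 (diam≤3 z v) v≢q₁
        ... | inj₂ z→q₁ | _         = z→q₁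
        ... | inj₁ _    | inj₂ z→q₁ = z→q₁
        ... | inj₁ z⇝u  | inj₁ z⇝v  =
          ⊥-elim (acyclic⇒no-detour acyclic u~q₁ q₁~q₂ u≢q₂ (∉∁⁅⁆ q₁)
                    (reach-trans G (reach-sym G z⇝u) (step z⇝v (Adj-sym G q₂~v) (∈∁⁅⁆ (Adj⇒≢ G q₁~q₂ ∘ sym)))))
        two-steps : DistLe G 2 z q₁ → ∃[ x ] (Adj G z x × Adj G x q₁)
        two-steps (inj₁ z≡q₁)                               = ⊥-elim (z≢q₁ z≡q₁)
        two-steps (inj₂ (x , z~x , inj₁ refl))               = ⊥-elim (q₁≁z (Adj-sym G z~x))
        two-steps (inj₂ (x , z~x , inj₂ (_ , x~q₁ , refl))) = x , z~x , x~q₁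

      geodesic-dominates : ∀ {u q₁ q₂ v} → Adj G u q₁ → Adj G q₁ q₂ → Adj G q₂ v → u ≢ q₂ → v ≢ q₁ →
                           DominatingEdge
      geodesic-dominates {u} {q₁} {q₂} {v} u~q₁ q₁~q₂ q₂~v u≢q₂ v≢q₁ =
        record { a = q₁ ; b = q₂ ; a~b = q₁~q₂ ; dominates = dominates }
        where
        dominates : ∀ z → z ≡ q₁ ⊎ z ≡ q₂ ⊎ Adj G q₁ z ⊎ Adj G q₂ z
        dominates z with z ≟ q₁ | z ≟ q₂ | Adj? G q₁ z | Adj? G q₂ z
        ... | yes z≡q₁ | _        | _        | _        = inj₁ z≡q₁
        ... | no _     | yes z≡q₂ | _        | _        = inj₂ (inj₁ z≡q₂)
        ... | no _     | no _     | yes q₁~z | _        = inj₂ (inj₂ (inj₁ q₁~z))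
        ... | no _     | no _     | no _     | yes q₂~z = inj₂ (inj₂ (inj₂ q₂~z))
        ... | no z≢q₁  | no z≢q₂  | no q₁≁z  | no q₂≁z
          with two-steps-to u~q₁ q₁~q₂ q₂~v u≢q₂ v≢q₁ z≢q₁ q₁≁z
             | two-steps-to (Adj-sym G q₂~v) (Adj-sym G q₁~q₂) (Adj-sym G u~q₁) v≢q₁ u≢q₂ z≢q₂ q₂≁z
        ... | x , z~x , x~q₁ | y , z~y , y~q₂ =
          ⊥-elim (acyclic⇒no-detour acyclic x~q₁ q₁~q₂ (λ { refl → q₂≁z (Adj-sym G z~x) }) (∉∁⁅⁆ q₁)
            (step (step (reach-edge G (∈∁⁅⁆ (Adj⇒≢ G x~q₁)) (Adj-sym G z~x) (∈∁⁅⁆ z≢q₁))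
                        z~y (∈∁⁅⁆ (λ { refl → q₁≁z (Adj-sym G z~y) })))
                  y~q₂ (∈∁⁅⁆ (Adj⇒≢ G q₁~q₂ ∘ sym))))

      star-dominates : (∀ x y → DistLe G 2 x y) → ∀ {u c v} → Adj G u c → Adj G c v → u ≢ v → DominatingEdge
      star-dominates diam≤2 {u} {c} {v} u~c c~v u≢v =
        record { a = c ; b = u ; a~b = Adj-sym G u~c ; dominates = dominates }
        where
        dominates : ∀ z → z ≡ c ⊎ z ≡ u ⊎ Adj G c z ⊎ Adj G u z
        dominates z with z ≟ c | Adj? G c z
        ... | yes z≡c | _       = inj₁ z≡c
        ... | no _    | yes c~z = inj₂ (inj₂ (inj₁ c~z))
        ... | no z≢c  | no c≁z  =
          ⊥-elim (acyclic⇒no-detour acyclic u~c c~v u≢v (∉∁⁅⁆ c)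
                    (reach-trans G (reach-sym G (avoid (diam≤2 z u) (Adj⇒≢ G u~c)))
                                   (avoid (diam≤2 z v) (Adj⇒≢ G c~v ∘ sym))))
          where
          avoid : ∀ {t} → DistLe G 2 z t → t ≢ c → Reach G (∁ ⁅ c ⁆) z t
          avoid z→t t≢c with avoid-or-near 1 z→t t≢c
          ... | inj₁ z⇝t                     = z⇝t
          ... | inj₂ (inj₁ z≡c)              = ⊥-elim (z≢c z≡c)
          ... | inj₂ (inj₂ (_ , z~c , refl)) = ⊥-elim (c≁z (Adj-sym G z~c))

      edge-dominates : (∀ x y → DistLe G 1 x y) → ∀ {x y} → x ≢ y → DominatingEdge
      edge-dominates diam≤1 {x} {y} x≢y =
        record { a = x ; b = y ; a~b = adjacent (diam≤1 x y) ; dominates = λ z → near (diam≤1 x z) }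
        where
        adjacent : DistLe G 1 x y → Adj G x y
        adjacent (inj₁ x≡y)              = ⊥-elim (x≢y x≡y)
        adjacent (inj₂ (_ , x~y , refl)) = x~y
        near : ∀ {z} → DistLe G 1 x z → z ≡ x ⊎ z ≡ y ⊎ Adj G x z ⊎ Adj G y z
        near (inj₁ x≡z)              = inj₁ (sym x≡z)
        near (inj₂ (_ , x~z , refl)) = inj₂ (inj₂ (inj₁ x~z))

      at-distance-3 : ∀ {u v} → DistLe G 3 u v → ¬ DistLe G 2 u v → DominatingEdge
      at-distance-3 (inj₁ refl) far = ⊥-elim (far (distLe-refl 2))
      at-distance-3 (inj₂ (_ , u~q₁ , inj₁ refl)) far = ⊥-elim (far (distLe-step u~q₁ (distLe-refl 1)))
      at-distance-3 (inj₂ (_ , u~q₁ , inj₂ (_ , q₁~q₂ , inj₁ refl))) far =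
        ⊥-elim (far (distLe-step u~q₁ (distLe-step q₁~q₂ refl)))
      at-distance-3 (inj₂ (_ , u~q₁ , inj₂ (_ , q₁~q₂ , inj₂ (_ , q₂~v , refl)))) far =
        geodesic-dominates u~q₁ q₁~q₂ q₂~v (λ { refl → far (distLe-step q₂~v (distLe-refl 1)) })
                                           (λ { refl → far (distLe-step u~q₁ (distLe-refl 1)) })

      at-distance-2 : (∀ x y → DistLe G 2 x y) → ∀ {u v} → DistLe G 2 u v → ¬ DistLe G 1 u v → DominatingEdge
      at-distance-2 diam≤2 (inj₁ refl) far = ⊥-elim (far (distLe-refl 1))
      at-distance-2 diam≤2 (inj₂ (_ , u~c , inj₁ refl)) far = ⊥-elim (far (distLe-step u~c refl))
      at-distance-2 diam≤2 (inj₂ (_ , u~c , inj₂ (_ , c~v , refl))) far =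
        star-dominates diam≤2 u~c c~v (λ { refl → far (distLe-refl 1) })

    dominatingEdge : ∀ {x y : Fin n} → x ≢ y → DominatingEdge
    dominatingEdge x≢y with any? (λ u → any? (λ v → ¬? (DistLe? 2 u v)))
    ... | yes (u , v , far) = at-distance-3 (diam≤3 u v) far
    ... | no ¬far₂ with any? (λ u → any? (λ v → ¬? (DistLe? 1 u v)))
    ...   | yes (u , v , far) = at-distance-2 diam≤2 (diam≤2 u v) far
      where
      diam≤2 : ∀ x y → DistLe G 2 x y
      diam≤2 x y = decidable-stable (DistLe? 2 x y) (λ far → ¬far₂ (x , y , far))
    ...   | no ¬far₁ = edge-dominates diam≤1 x≢y
      where
      diam≤1 : ∀ x y → DistLe G 1 x y
      diam≤1 x y = decidable-stable (DistLe? 1 x y) (λ far → ¬far₁ (x , y , far))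

-- Double stars belong to 𝒢ᶜˢ

module DominatingEdgeInTree {n} {G : Graph n} (acyclic : Acyclic G) (e : DominatingEdge G) where
  open DominatingEdge e

  no-common-neighbour : ∀ {z} → Adj G a z → ¬ Adj G b z
  no-common-neighbour a~z b~z = acyclic⇒triangle-free G acyclic a~z (Adj-sym G b~z) (Adj-sym G a~b)

  -- Two adjacent non-centres would close a triangle or a 4-cycle with the centres.
  leaf-neighbour : ∀ {z y} → z ≢ a → z ≢ b → Adj G z y → y ≡ a ⊎ y ≡ b
  leaf-neighbour {z} {y} z≢a z≢b z~y with y ≟ a | y ≟ b
  ... | yes y≡a | _       = inj₁ y≡a
  ... | no _    | yes y≡b = inj₂ y≡b
  ... | no y≢a  | no y≢b  = ⊥-elim (cases (dominates z) (dominates y))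
    where
    cases : z ≡ a ⊎ z ≡ b ⊎ Adj G a z ⊎ Adj G b z → y ≡ a ⊎ y ≡ b ⊎ Adj G a y ⊎ Adj G b y → ⊥
    cases (inj₁ z≡a) _ = z≢a z≡a
    cases (inj₂ (inj₁ z≡b)) _ = z≢b z≡b
    cases _ (inj₁ y≡a) = y≢a y≡a
    cases _ (inj₂ (inj₁ y≡b)) = y≢b y≡b
    cases (inj₂ (inj₂ (inj₁ a~z))) (inj₂ (inj₂ (inj₁ a~y))) =
      acyclic⇒triangle-free G acyclic a~z z~y (Adj-sym G a~y)
    cases (inj₂ (inj₂ (inj₂ b~z))) (inj₂ (inj₂ (inj₂ b~y))) =
      acyclic⇒triangle-free G acyclic b~z z~y (Adj-sym G b~y)
    cases (inj₂ (inj₂ (inj₁ a~z))) (inj₂ (inj₂ (inj₂ b~y))) =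
      acyclic⇒no-detour G acyclic (Adj-sym G a~z) a~b z≢b (∉∁⁅⁆ a)
        (step (reach-edge G (∈∁⁅⁆ z≢a) z~y (∈∁⁅⁆ y≢a)) (Adj-sym G b~y) (∈∁⁅⁆ (Adj⇒≢ G a~b ∘ sym)))
    cases (inj₂ (inj₂ (inj₂ b~z))) (inj₂ (inj₂ (inj₁ a~y))) =
      acyclic⇒no-detour G acyclic (Adj-sym G b~z) (Adj-sym G a~b) z≢a (∉∁⁅⁆ b)
        (step (reach-edge G (∈∁⁅⁆ z≢b) z~y (∈∁⁅⁆ y≢b)) (Adj-sym G a~y) (∈∁⁅⁆ (Adj⇒≢ G a~b)))

  leaf-of-a : ∀ {z y} → Adj G a z → z ≢ b → Adj G z y → y ≡ a
  leaf-of-a a~z z≢b z~y with leaf-neighbour (Adj⇒≢ G a~z ∘ sym) z≢b z~y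
  ... | inj₁ y≡a  = y≡a
  ... | inj₂ refl = ⊥-elim (no-common-neighbour a~z (Adj-sym G z~y))

  leaf-of-b : ∀ {z y} → Adj G b z → z ≢ a → Adj G z y → y ≡ b
  leaf-of-b b~z z≢a z~y with leaf-neighbour z≢a (Adj⇒≢ G b~z ∘ sym) z~y
  ... | inj₁ refl = ⊥-elim (no-common-neighbour (Adj-sym G z~y) b~z)
  ... | inj₂ y≡b  = y≡b

  centres-connected : ∀ {X} → a ∈ X → b ∈ X → ConnectedIn G X
  centres-connected {X} a∈X b∈X u v u∈X v∈X = reach-trans G (reach-sym G (from-a u∈X)) (from-a v∈X)
    where
    from-a : ∀ {u} → u ∈ X → Reach G X a u
    from-a {u} u∈X with dominates u
    ... | inj₁ refl               = here a∈X
    ... | inj₂ (inj₁ refl)        = reach-edge G a∈X a~b b∈X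
    ... | inj₂ (inj₂ (inj₁ a~u)) = reach-edge G a∈X a~u u∈X
    ... | inj₂ (inj₂ (inj₂ b~u)) = step (reach-edge G a∈X a~b b∈X) b~u u∈X

  module _ {w : Weight n} (w≥0 : NonNegative w) where

    -- Once both centres are in X, every vertex outside X is a leaf whose neighbour lies in X.
    centres-connSafe : ∀ {X} → a ∈ X → b ∈ X → (∀ {v} → v ∉ X → w v ≤ wsum w X) → IsConnSafe G w X
    centres-connSafe {X} a∈X b∈X light = connSafe-intro G w≥0 (a , a∈X) (centres-connected a∈X b∈X) bound
      where
      bound : ∀ {v} → v ∉ X → wsum w (component G (∁ X) v) ≤ wsum w X
      bound {v} v∉X = ℚ.≤-trans (isolated⇒component≤ G w≥0 isolated) (light v∉X)
        where
        isolated : ∀ u → Adj G v u → u ∉ ∁ X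
        isolated u v~u with leaf-neighbour (λ { refl → v∉X a∈X }) (λ { refl → v∉X b∈X }) v~u
        ... | inj₁ refl = x∈p⇒x∉∁p a∈X
        ... | inj₂ refl = x∈p⇒x∉∁p b∈X

  module Lighter {w : Weight n} (w>0 : Positive w) {S : Subset n} (S-safe : IsSafe G w S) where

    private
      w≥0 : NonNegative w
      w≥0 = positive⇒nonNegative w>0

    both-in : a ∈ S → b ∈ S → LighterConnSafe G w S
    both-in a∈S b∈S = S , (S-safe , centres-connected a∈S b∈S) , ℚ.≤-refl

    -- S consists of leaves, each heavier than the component of ∁ S containing both centres.
    both-out : a ∉ S → b ∉ S → LighterConnSafe G w S
    both-out a∉S b∉S with argmax w (proj₁ S-safe)
    ... | l , l∈S , w≤wl with any? (λ x → x ∈? S ×-dec ¬? (x ≟ l))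
    ...   | no ¬other = S , (S-safe , connected) , ℚ.≤-refl
      where
      is-l : ∀ {u} → u ∈ S → u ≡ l
      is-l {u} u∈S = decidable-stable (u ≟ l) (λ u≢l → ¬other (u , u∈S , u≢l))
      connected : ConnectedIn G S
      connected u v u∈S v∈S = subst (Reach G S u) (trans (is-l u∈S) (sym (is-l v∈S))) (here u∈S)
    ...   | yes (l′ , l′∈S , l′≢l) = S′ , centres-connSafe w≥0 a∈S′ b∈S′ light , lighter
      where
      D₀ : Subset n
      D₀ = component G (∁ S) a
      a∈∁S : a ∈ ∁ S
      a∈∁S = x∉p⇒x∈∁p a∉S
      ∁S⊆D₀ : ∀ {v} → v ∉ S → v ∈ D₀
      ∁S⊆D₀ {v} v∉S with dominates v
      ... | inj₁ refl               = x∈component G a∈∁S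
      ... | inj₂ (inj₁ refl)        = ∈component⁺ G (reach-edge G a∈∁S a~b (x∉p⇒x∈∁p b∉S))
      ... | inj₂ (inj₂ (inj₁ a~v)) = ∈component⁺ G (reach-edge G a∈∁S a~v (x∉p⇒x∈∁p v∉S))
      ... | inj₂ (inj₂ (inj₂ b~v)) =
        ∈component⁺ G (step (reach-edge G a∈∁S a~b (x∉p⇒x∈∁p b∉S)) b~v (x∉p⇒x∈∁p v∉S))
      via-neighbour : ∀ {x v} → x ∈ S → v ∉ S → Adj G x v → wsum w D₀ ≤ w x
      via-neighbour {x} x∈S v∉S x~v =
        ℚ.≤-trans (safe⇒component≤component G w≥0 S-safe x∈S a∉S (x∈component G x∈S) (∁S⊆D₀ v∉S) x~v)
                  (isolated⇒component≤ G w≥0 isolated)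
        where
        isolated : ∀ u → Adj G x u → u ∉ S
        isolated u x~u with leaf-neighbour (λ { refl → a∉S x∈S }) (λ { refl → b∉S x∈S }) x~u
        ... | inj₁ refl = a∉S
        ... | inj₂ refl = b∉S
      D₀≤ : ∀ {x} → x ∈ S → wsum w D₀ ≤ w x
      D₀≤ {x} x∈S with dominates x
      ... | inj₁ refl               = ⊥-elim (a∉S x∈S)
      ... | inj₂ (inj₁ refl)        = ⊥-elim (b∉S x∈S)
      ... | inj₂ (inj₂ (inj₁ a~x)) = via-neighbour x∈S a∉S (Adj-sym G a~x)
      ... | inj₂ (inj₂ (inj₂ b~x)) = via-neighbour x∈S b∉S (Adj-sym G b~x)
      S′ : Subset n
      S′ = ⁅ l ⁆ ∪ ⁅ a ⁆ ∪ ⁅ b ⁆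
      a∈S′ : a ∈ S′
      a∈S′ = x∈p∪q⁺ (inj₂ (x∈p∪q⁺ (inj₁ (x∈⁅x⁆ a))))
      b∈S′ : b ∈ S′
      b∈S′ = x∈p∪q⁺ (inj₂ (x∈p∪q⁺ (inj₂ (x∈⁅x⁆ b))))
      wl≤S′ : w l ≤ wsum w S′
      wl≤S′ = w≤wsum w≥0 (x∈p∪q⁺ (inj₁ (x∈⁅x⁆ l)))
      light : ∀ {v} → v ∉ S′ → w v ≤ wsum w S′
      light {v} _ with v ∈? S
      ... | yes v∈S = ℚ.≤-trans (w≤wl v∈S) wl≤S′
      ... | no  v∉S = ℚ.≤-trans (w≤wsum w≥0 (∁S⊆D₀ v∉S)) (ℚ.≤-trans (D₀≤ l∈S) wl≤S′)
      lighter : wsum w S′ ≤ wsum w S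
      lighter = begin
        wsum w S′                       ≤⟨ wsum-⁅⁆∪ w≥0 l (⁅ a ⁆ ∪ ⁅ b ⁆) ⟩
        w l + wsum w (⁅ a ⁆ ∪ ⁅ b ⁆)    ≤⟨ ℚ.+-monoʳ-≤ (w l) (wsum-⁅⁆∪ w≥0 a ⁅ b ⁆) ⟩
        w l + (w a + wsum w ⁅ b ⁆)      ≡⟨ cong (λ q → w l + (w a + q)) (wsum-⁅⁆ w b) ⟩
        w l + (w a + w b)               ≤⟨ ℚ.+-monoʳ-≤ (w l) (wsum-pair w≥0 (Adj⇒≢ G a~b) (x∈component G a∈∁S)
                                                                               (∁S⊆D₀ b∉S)) ⟩
        w l + wsum w D₀                 ≤⟨ ℚ.+-monoʳ-≤ (w l) (D₀≤ l′∈S) ⟩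
        w l + w l′                      ≤⟨ wsum-pair w≥0 (l′≢l ∘ sym) l∈S l′∈S ⟩
        wsum w S                        ∎
        where open ℚ.≤-Reasoning

    module OneIn (a∈S : a ∈ S) (b∉S : b ∉ S) where

      Ca Db : Subset n
      Ca = component G S a
      Db = component G (∁ S) b

      b∈∁S : b ∈ ∁ S
      b∈∁S = x∉p⇒x∈∁p b∉S

      Ca-shape : ∀ {u} → u ∈ Ca → u ≡ a ⊎ Adj G a u
      Ca-shape u∈Ca = shape (∈component⁻ G u∈Ca)
        where
        shape : ∀ {u} → Reach G S a u → u ≡ a ⊎ Adj G a u
        shape (here _) = inj₁ refl
        shape (step walk t~u u∈S) with shape walk
        ... | inj₁ refl = inj₂ t~u
        ... | inj₂ a~t  = inj₁ (leaf-of-a a~t (λ { refl → b∉S (reach-target G walk) }) t~u)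

      b-leaf : ∀ {u} → u ∈ S → u ∉ Ca → Adj G b u
      b-leaf {u} u∈S u∉Ca with dominates u
      ... | inj₁ refl               = ⊥-elim (u∉Ca (x∈component G a∈S))
      ... | inj₂ (inj₁ refl)        = ⊥-elim (b∉S u∈S)
      ... | inj₂ (inj₂ (inj₁ a~u)) = ⊥-elim (u∉Ca (∈component⁺ G (reach-edge G a∈S a~u u∈S)))
      ... | inj₂ (inj₂ (inj₂ b~u)) = b~u

      Db≤Ca : wsum w Db ≤ wsum w Ca
      Db≤Ca = safe⇒component≤component G w≥0 S-safe a∈S b∉S (x∈component G a∈S) (x∈component G b∈∁S) a~b

      Db≤b-leaf : ∀ {y} → y ∈ S → y ∉ Ca → wsum w Db ≤ w y
      Db≤b-leaf {y} y∈S y∉Ca = begin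
        wsum w Db                  ≤⟨ safe⇒component≤component G w≥0 S-safe y∈S b∉S (x∈component G y∈S)
                                        (x∈component G b∈∁S) (Adj-sym G (b-leaf y∈S y∉Ca)) ⟩
        wsum w (component G S y)   ≤⟨ isolated⇒component≤ G w≥0 isolated ⟩
        w y                        ∎
        where
        open ℚ.≤-Reasoning
        isolated : ∀ u → Adj G y u → u ∉ S
        isolated u y~u with leaf-of-b (b-leaf y∈S y∉Ca) (λ { refl → y∉Ca (x∈component G a∈S) }) y~u
        ... | refl = b∉S

      b≤Db : w b ≤ wsum w Db
      b≤Db = w≤wsum w≥0 (x∈component G b∈∁S)

      b-leaf≤Db : ∀ {v} → v ∉ S → Adj G b v → w v ≤ wsum w Db
      b-leaf≤Db v∉S b~v = w≤wsum w≥0 (∈component⁺ G (reach-edge G b∈∁S b~v (x∉p⇒x∈∁p v∉S)))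

      a-leaf≤Ca : ∀ {x} → x ∉ S → Adj G a x → w x ≤ wsum w Ca
      a-leaf≤Ca {x} x∉S a~x =
        ℚ.≤-trans (w≤wsum w≥0 (x∈component G x∈∁S))
                  (safe⇒component≤component G w≥0 S-safe a∈S x∉S (x∈component G a∈S) (x∈component G x∈∁S) a~x)
        where
        x∈∁S : x ∈ ∁ S
        x∈∁S = x∉p⇒x∈∁p x∉S

      outside≤Ca : ∀ {v} → v ∉ S → v ≢ b → w v ≤ wsum w Ca
      outside≤Ca {v} v∉S v≢b with dominates v
      ... | inj₁ refl               = ⊥-elim (v∉S a∈S)
      ... | inj₂ (inj₁ v≡b)         = ⊥-elim (v≢b v≡b)
      ... | inj₂ (inj₂ (inj₁ a~v)) = a-leaf≤Ca v∉S a~v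
      ... | inj₂ (inj₂ (inj₂ b~v)) = ℚ.≤-trans (b-leaf≤Db v∉S b~v) Db≤Ca

      -- y is a leaf at b inside S; trading y for b plus some leaves at a outside S.
      module Trade {y} (y∈S : y ∈ S) (y∉Ca : y ∉ Ca) where

        Ca⊆S-y : Ca ⊆ S - y
        Ca⊆S-y u∈Ca = x∈p∧x≢y⇒x∈p-y (component⊆ G u∈Ca) (λ { refl → y∉Ca u∈Ca })

        candidates : Subset n
        candidates = (neighbours G a ─ S) - b

        pad : Subset n → Subset n
        pad P = ⁅ b ⁆ ∪ (S - y) ∪ P

        Fits : Subset n → Set
        Fits P = w y ≤ wsum w (pad P)

        b∈pad : ∀ P → b ∈ pad P
        b∈pad P = x∈p∪q⁺ (inj₁ (x∈⁅x⁆ b))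

        S-y⊆pad : ∀ P → S - y ⊆ pad P
        S-y⊆pad P u∈S-y = x∈p∪q⁺ (inj₂ (x∈p∪q⁺ (inj₁ u∈S-y)))

        P⊆pad : ∀ P → P ⊆ pad P
        P⊆pad P u∈P = x∈p∪q⁺ (inj₂ (x∈p∪q⁺ (inj₂ u∈P)))

        ∈pad⁻ : ∀ P {u} → u ∈ pad P → u ≡ b ⊎ u ∈ S - y ⊎ u ∈ P
        ∈pad⁻ P u∈pad with x∈p∪q⁻ ⁅ b ⁆ _ u∈pad
        ... | inj₁ u∈⁅b⁆   = inj₁ (x∈⁅y⁆⇒x≡y b u∈⁅b⁆)
        ... | inj₂ u∈S-y∪P = inj₂ (x∈p∪q⁻ (S - y) P u∈S-y∪P)

        Ca≤pad : ∀ P → wsum w Ca ≤ wsum w (pad P)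
        Ca≤pad P = wsum-mono w≥0 (S-y⊆pad P ∘ Ca⊆S-y)

        pad-connSafe : ∀ P → Fits P → IsConnSafe G w (pad P)
        pad-connSafe P fits = centres-connSafe w≥0 (S-y⊆pad P (Ca⊆S-y (x∈component G a∈S))) (b∈pad P) light
          where
          light : ∀ {v} → v ∉ pad P → w v ≤ wsum w (pad P)
          light {v} v∉pad with v ≟ y
          ... | yes refl = fits
          ... | no  v≢y  = ℚ.≤-trans (outside≤Ca v∉S (λ { refl → v∉pad (b∈pad P) })) (Ca≤pad P)
            where
            v∉S : v ∉ S
            v∉S v∈S = v∉pad (S-y⊆pad P (x∈p∧x≢y⇒x∈p-y v∈S v≢y))

        -- Dropping any x from a minimal fitting P leaves a pad lighter than y, and w x ≤ wsum w Ca.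
        minimal-pad-lighter : ∀ {P} → P ⊆ candidates → (∀ {x} → x ∈ P → ¬ Fits (P - x)) →
                              wsum w (pad P) ≤ wsum w S
        minimal-pad-lighter {P} P⊆cand minimal = begin
          wsum w (pad P)      ≤⟨ pad≤ ⟩
          w y + wsum w (S - y) ≡⟨ sym (wsum-split w y∈S) ⟩
          wsum w S            ∎
          where
          open ℚ.≤-Reasoning
          pad≤ : wsum w (pad P) ≤ w y + wsum w (S - y)
          pad≤ with nonempty? P
          ... | no P≡∅ = begin
            wsum w (pad P)               ≤⟨ wsum-mono w≥0 pad⊆ ⟩
            wsum w (⁅ b ⁆ ∪ (S - y))     ≤⟨ wsum-⁅⁆∪ w≥0 b (S - y) ⟩
            w b + wsum w (S - y)         ≤⟨ ℚ.+-monoˡ-≤ (wsum w (S - y)) (ℚ.≤-trans b≤Db (Db≤b-leaf y∈S y∉Ca)) ⟩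
            w y + wsum w (S - y)         ∎
            where
            pad⊆ : pad P ⊆ ⁅ b ⁆ ∪ (S - y)
            pad⊆ {u} u∈pad with ∈pad⁻ P u∈pad
            ... | inj₁ refl         = x∈p∪q⁺ (inj₁ (x∈⁅x⁆ b))
            ... | inj₂ (inj₁ u∈S-y) = x∈p∪q⁺ (inj₂ u∈S-y)
            ... | inj₂ (inj₂ u∈P)   = ⊥-elim (P≡∅ (u , u∈P))
          ... | yes (x , x∈P) = begin
            wsum w (pad P)                ≤⟨ wsum-mono w≥0 pad⊆ ⟩
            wsum w (⁅ x ⁆ ∪ pad (P - x))  ≤⟨ wsum-⁅⁆∪ w≥0 x (pad (P - x)) ⟩
            w x + wsum w (pad (P - x))    ≤⟨ ℚ.+-mono-≤ x≤S-y (ℚ.<⇒≤ (ℚ.≰⇒> (minimal x∈P))) ⟩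
            wsum w (S - y) + w y          ≡⟨ ℚ.+-comm (wsum w (S - y)) (w y) ⟩
            w y + wsum w (S - y)          ∎
            where
            x≤S-y : w x ≤ wsum w (S - y)
            x≤S-y with P⊆cand x∈P
            ... | x∈cand = ℚ.≤-trans (a-leaf≤Ca (x∈p─q⇒x∉q x∈N─S) (∈subset⁻ (Adj? G a) (p─q⊆p _ _ x∈N─S)))
                                     (wsum-mono w≥0 Ca⊆S-y)
              where
              x∈N─S : x ∈ neighbours G a ─ S
              x∈N─S = p─q⊆p _ _ x∈cand
            pad⊆ : pad P ⊆ ⁅ x ⁆ ∪ pad (P - x)
            pad⊆ {u} u∈pad with ∈pad⁻ P u∈pad
            ... | inj₁ refl         = x∈p∪q⁺ (inj₂ (b∈pad (P - x)))
            ... | inj₂ (inj₁ u∈S-y) = x∈p∪q⁺ (inj₂ (S-y⊆pad (P - x) u∈S-y))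
            ... | inj₂ (inj₂ u∈P) with u ≟ x
            ...   | yes refl = x∈p∪q⁺ (inj₁ (x∈⁅x⁆ x))
            ...   | no  u≢x  = x∈p∪q⁺ (inj₂ (P⊆pad (P - x) (x∈p∧x≢y⇒x∈p-y u∈P u≢x)))

        fallback : ¬ Fits candidates → LighterConnSafe G w S
        fallback unfit = S₃ , connSafe-intro G w≥0 (b , b∈S₃) S₃-connected bound , lighter
          where
          S₃ : Subset n
          S₃ = ⁅ b ⁆ ∪ (S ─ Ca)
          b∈S₃ : b ∈ S₃
          b∈S₃ = x∈p∪q⁺ (inj₁ (x∈⁅x⁆ b))
          y≤S₃ : w y ≤ wsum w S₃
          y≤S₃ = w≤wsum w≥0 {X = S₃} (x∈p∪q⁺ (inj₂ (x∈p∧x∉q⇒x∈p─q y∈S y∉Ca)))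

          S₃-connected : ConnectedIn G S₃
          S₃-connected u v u∈S₃ v∈S₃ = reach-trans G (reach-sym G (from-b u∈S₃)) (from-b v∈S₃)
            where
            from-b : ∀ {u} → u ∈ S₃ → Reach G S₃ b u
            from-b {u} u∈S₃ with x∈p∪q⁻ ⁅ b ⁆ (S ─ Ca) u∈S₃
            ... | inj₁ u∈⁅b⁆  = subst (Reach G S₃ b) (sym (x∈⁅y⁆⇒x≡y b u∈⁅b⁆)) (here b∈S₃)
            ... | inj₂ u∈S─Ca = reach-edge G b∈S₃ (b-leaf (p─q⊆p S Ca u∈S─Ca) (x∈p─q⇒x∉q u∈S─Ca)) u∈S₃

          -- A component of ∁ S₃ meeting the star of a lies inside pad candidates, which is lighter than y.
          a-side : ∀ {v} → v ≡ a ⊎ (Adj G a v × v ≢ b) → wsum w (component G (∁ S₃) v) ≤ wsum w S₃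
          a-side v-near-a =
            ℚ.≤-trans (wsum-mono w≥0 (λ u∈C → near-a⊆pad (stays v-near-a (∈component⁻ G u∈C))))
                      (ℚ.≤-trans (ℚ.<⇒≤ (ℚ.≰⇒> unfit)) y≤S₃)
            where
            stays : ∀ {u t} → u ≡ a ⊎ (Adj G a u × u ≢ b) → Reach G (∁ S₃) u t → t ≡ a ⊎ (Adj G a t × t ≢ b)
            stays near (here _) = near
            stays near (step walk s~t t∈∁S₃) with stays near walk
            ... | inj₁ refl        = inj₂ (s~t , λ { refl → x∈∁p⇒x∉p t∈∁S₃ b∈S₃ })
            ... | inj₂ (a~s , s≢b) = inj₁ (leaf-of-a a~s s≢b s~t)
            near-a⊆pad : ∀ {u} → u ≡ a ⊎ (Adj G a u × u ≢ b) → u ∈ pad candidates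
            near-a⊆pad (inj₁ refl) = S-y⊆pad candidates (Ca⊆S-y (x∈component G a∈S))
            near-a⊆pad {u} (inj₂ (a~u , u≢b)) with u ∈? S
            ... | yes u∈S = S-y⊆pad candidates (Ca⊆S-y (∈component⁺ G (reach-edge G a∈S a~u u∈S)))
            ... | no  u∉S = P⊆pad candidates (x∈p∧x≢y⇒x∈p-y (x∈p∧x∉q⇒x∈p─q (∈subset⁺ (Adj? G a) a~u) u∉S) u≢b)

          b-side : ∀ {v} → Adj G b v → v ≢ a → v ∉ S₃ → wsum w (component G (∁ S₃) v) ≤ wsum w S₃
          b-side {v} b~v v≢a v∉S₃ = begin
            wsum w (component G (∁ S₃) v) ≤⟨ isolated⇒component≤ G w≥0 isolated ⟩
            w v                           ≤⟨ b-leaf≤Db v∉S b~v ⟩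
            wsum w Db                     ≤⟨ Db≤b-leaf y∈S y∉Ca ⟩
            w y                           ≤⟨ y≤S₃ ⟩
            wsum w S₃                     ∎
            where
            open ℚ.≤-Reasoning
            v∉Ca : v ∉ Ca
            v∉Ca v∈Ca with Ca-shape v∈Ca
            ... | inj₁ v≡a = v≢a v≡a
            ... | inj₂ a~v = no-common-neighbour a~v b~v
            v∉S : v ∉ S
            v∉S v∈S = v∉S₃ (x∈p∪q⁺ (inj₂ (x∈p∧x∉q⇒x∈p─q v∈S v∉Ca)))
            isolated : ∀ u → Adj G v u → u ∉ ∁ S₃
            isolated u v~u with leaf-of-b b~v v≢a v~u
            ... | refl = x∈p⇒x∉∁p b∈S₃

          bound : ∀ {v} → v ∉ S₃ → wsum w (component G (∁ S₃) v) ≤ wsum w S₃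
          bound {v} v∉S₃ with v ≟ a
          ... | yes v≡a = a-side (inj₁ v≡a)
          ... | no  v≢a with dominates v
          ...   | inj₁ v≡a               = ⊥-elim (v≢a v≡a)
          ...   | inj₂ (inj₁ refl)        = ⊥-elim (v∉S₃ b∈S₃)
          ...   | inj₂ (inj₂ (inj₁ a~v)) = a-side (inj₂ (a~v , λ { refl → v∉S₃ b∈S₃ }))
          ...   | inj₂ (inj₂ (inj₂ b~v)) = b-side b~v v≢a v∉S₃

          lighter : wsum w S₃ ≤ wsum w S
          lighter = begin
            wsum w S₃                          ≤⟨ wsum-⁅⁆∪ w≥0 b (S ─ Ca) ⟩
            w b + wsum w (S ─ Ca)              ≤⟨ ℚ.+-monoˡ-≤ (wsum w (S ─ Ca)) b≤S∩Ca ⟩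
            wsum w (S ∩ Ca) + wsum w (S ─ Ca)  ≡⟨ ℚ.+-comm (wsum w (S ∩ Ca)) (wsum w (S ─ Ca)) ⟩
            wsum w (S ─ Ca) + wsum w (S ∩ Ca)  ≡⟨ wsum-─∩ w S Ca ⟩
            wsum w S                           ∎
            where
            open ℚ.≤-Reasoning
            b≤S∩Ca : w b ≤ wsum w (S ∩ Ca)
            b≤S∩Ca = ℚ.≤-trans b≤Db (ℚ.≤-trans Db≤Ca (wsum-mono w≥0 (λ u∈Ca → x∈p∩q⁺ (component⊆ G u∈Ca , u∈Ca))))

        lighter : LighterConnSafe G w S
        lighter with w y ℚ.≤? wsum w (pad candidates)
        ... | no  unfit = fallback unfit
        ... | yes fits
          with minimum (λ P → P ⊆? candidates ×-dec w y ℚ.≤? wsum w (pad P)) (wsum w) (candidates , ⊆-refl , fits)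
        ... | P , (P⊆cand , P-fits) , P-min = pad P , pad-connSafe P P-fits , minimal-pad-lighter P⊆cand minimal
          where
          minimal : ∀ {x} → x ∈ P → ¬ Fits (P - x)
          minimal {x} x∈P fits′ =
            ℚ.<-irrefl refl (ℚ.<-≤-trans (wsum-remove-< w>0 x∈P) (P-min (P - x) (P⊆cand ∘ p─q⊆p P ⁅ x ⁆ , fits′)))

      one-in : LighterConnSafe G w S
      one-in with nonempty? (S ─ Ca)
      ... | yes (y , y∈S─Ca) = Trade.lighter (p─q⊆p S Ca y∈S─Ca) (x∈p─q⇒x∉q y∈S─Ca)
      ... | no  S─Ca≡∅ = S , (S-safe , connected) , ℚ.≤-refl
        where
        S⊆Ca : ∀ {u} → u ∈ S → u ∈ Ca
        S⊆Ca {u} u∈S with u ∈? Ca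
        ... | yes u∈Ca = u∈Ca
        ... | no  u∉Ca = ⊥-elim (S─Ca≡∅ (u , x∈p∧x∉q⇒x∈p─q u∈S u∉Ca))
        connected : ConnectedIn G S
        connected u v u∈S v∈S = reach-trans G (reach-sym G (∈component⁻ G (S⊆Ca u∈S))) (∈component⁻ G (S⊆Ca v∈S))

dominatingEdge⇒lighterConnSafe : ∀ {n} {G : Graph n} → Acyclic G → DominatingEdge G →
  ∀ {w} → Positive w → ∀ {S} → IsSafe G w S → LighterConnSafe G w S
dominatingEdge⇒lighterConnSafe {G = G} acyclic e {w} w>0 {S} S-safe = lighter (a ∈? S) (b ∈? S)
  where
  open DominatingEdge e
  module L  = DominatingEdgeInTree.Lighter acyclic e w>0 S-safe
  module L′ = DominatingEdgeInTree.Lighter acyclic (swap G e) w>0 S-safe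
  lighter : Dec (a ∈ S) → Dec (b ∈ S) → LighterConnSafe G w S
  lighter (yes a∈S) (yes b∈S) = L.both-in a∈S b∈S
  lighter (no  a∉S) (no  b∉S) = L.both-out a∉S b∉S
  lighter (yes a∈S) (no  b∉S) = L.OneIn.one-in a∈S b∉S
  lighter (no  a∉S) (yes b∈S) = L′.OneIn.one-in b∈S a∉S

doubleStar⇒InGcs : ∀ {n} (T : Graph n) → IsDoubleStar T → InGcs T
doubleStar⇒InGcs T ((_ , _ , acyclic) , diam≤3) = InGcs-intro T lighter
  where
  lighter : ∀ w → Positive w → ∀ S → IsSafe T w S → LighterConnSafe T w S
  lighter w w>0 S S-safe with any? (λ x → any? (λ y → ¬? (x ≟ y)))
  ... | yes (x , y , x≢y) = dominatingEdge⇒lighterConnSafe acyclic (dominatingEdge T acyclic diam≤3 x≢y) w>0 S-safe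
  ... | no  ¬x≢y = S , (S-safe , connected) , ℚ.≤-refl
    where
    connected : ConnectedIn T S
    connected u v u∈S _ = subst (Reach T S u) (decidable-stable (u ≟ v) (λ u≢v → ¬x≢y (u , v , u≢v))) (here u∈S)

-- Trees of diameter at least four do not belong to 𝒢ᶜˢ

module _ {m} {G : Graph (suc m)} (acyclic : Acyclic G) (G-conn : Connected G) where

  private
    N : ℕ
    N = suc m

  opaque
    heavy : ℕ → ℚ
    heavy k = fromℕ (k ℕ.* N)

    heavy-0 : heavy 0 ≡ 0ℚ
    heavy-0 = refl

    heavy-+ : ∀ a b → heavy a + heavy b ≡ heavy (a ℕ.+ b)
    heavy-+ a b = sym (trans (cong fromℕ (ℕ.*-distribʳ-+ N a b)) (fromℕ-+ (a ℕ.* N) (b ℕ.* N)))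

    heavy-< : ∀ {a b} → a ℕ.< b → heavy a < heavy b
    heavy-< a<b = fromℕ-mono-< (ℕ.*-monoˡ-< N a<b)

    heavy-1 : fromℕ N ≡ heavy 1
    heavy-1 = cong fromℕ (sym (ℕ.*-identityˡ N))

  heavy-positive : ∀ k → 0ℚ < heavy (suc k)
  heavy-positive k = subst (_< heavy (suc k)) heavy-0 (heavy-< (ℕ.s≤s ℕ.z≤n))

  heavy-squeeze : ∀ {q a b} → heavy b ≤ q → q ≤ heavy a → a ℕ.< b → ⊥
  heavy-squeeze b≤q q≤a a<b = ℚ.<-irrefl refl (ℚ.<-≤-trans (heavy-< a<b) (ℚ.≤-trans b≤q q≤a))

  -- Weights 4, 5, 2, 5, 4 (in units of N) along the path and 1 elsewhere, so that all vertices
  -- off the path together weigh at most one unit.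
  record PathWeight (P : Path₅ G) (w : Weight N) : Set where
    open Path₅ P
    field
      w₀ : w p₀ ≡ heavy 4
      w₁ : w p₁ ≡ heavy 5
      w₂ : w p₂ ≡ heavy 2
      w₃ : w p₃ ≡ heavy 5
      w₄ : w p₄ ≡ heavy 4
      off-path : ∀ v → All (v ≢_) (p₀ ∷ p₁ ∷ p₂ ∷ p₃ ∷ p₄ ∷ []) → w v ≡ 1ℚ

  reverse-weight : ∀ {P w} → PathWeight P w → PathWeight (reverse G P) w
  reverse-weight pw = record
    { w₀ = w₄ ; w₁ = w₃ ; w₂ = w₂ ; w₃ = w₁ ; w₄ = w₀
    ; off-path = λ { v (≢₄ ∷ ≢₃ ∷ ≢₂ ∷ ≢₁ ∷ ≢₀ ∷ []) → off-path v (≢₀ ∷ ≢₁ ∷ ≢₂ ∷ ≢₃ ∷ ≢₄ ∷ []) } }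
    where open PathWeight pw

  module OnPath (P : Path₅ G) {w : Weight N} (pw : PathWeight P w) (w≥0 : NonNegative w) where
    open Path₅ P
    open PathWeight pw

    weighs : ∀ {xs ks} → Pointwise (λ x k → w x ≡ heavy k) xs ks → wsumList w xs ≡ heavy (sum ks)
    weighs []                      = sym heavy-0
    weighs {ks = k ∷ ks} (wx ∷ wxs) = trans (cong₂ _+_ wx (weighs wxs)) (heavy-+ k (sum ks))

    lower : ∀ {X xs ks} → Unique xs → All (_∈ X) xs → Pointwise (λ x k → w x ≡ heavy k) xs ks →
            heavy (sum ks) ≤ wsum w X
    lower {X} xs! xs⊆X wxs = subst (_≤ wsum w X) (weighs wxs) (wsum-distinct w≥0 xs! xs⊆X)

    upper : ∀ {X xs ks} → All (λ p → p ∉ X ⊎ p ∈ₗ xs) (p₀ ∷ p₁ ∷ p₂ ∷ p₃ ∷ p₄ ∷ []) →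
            Pointwise (λ x k → w x ≡ heavy k) xs ks → wsum w X ≤ heavy (sum ks ℕ.+ 1)
    upper {X} {xs} {ks} path∩X⊆xs wxs = subst (wsum w X ≤_) bound (wsum-cover w≥0 xs cover)
      where
      bound : wsumList w xs + fromℕ N ≡ heavy (sum ks ℕ.+ 1)
      bound = trans (cong (_+ fromℕ N) (weighs wxs)) (trans (cong (heavy (sum ks) +_) heavy-1) (heavy-+ (sum ks) 1))
      cover : ∀ {v} → v ∈ X → v ∈ₗ xs ⊎ w v ≤ 1ℚ
      cover {v} v∈X with Any.any? (v ≟_) xs
      ... | yes v∈xs = inj₁ v∈xs
      ... | no  v∉xs = inj₂ (ℚ.≤-reflexive (off-path v (All.map avoid path∩X⊆xs)))
        where
        avoid : ∀ {p} → p ∉ X ⊎ p ∈ₗ xs → v ≢ p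
        avoid (inj₁ p∉X)  refl = p∉X v∈X
        avoid (inj₂ p∈xs) refl = v∉xs p∈xs

    p₀∉ : ∀ {X} → ConnectedIn G X → p₁ ∉ X → p₂ ∈ X → p₀ ∉ X
    p₀∉ X-conn p₁∉X p₂∈X p₀∈X = acyclic⇒no-detour G acyclic p₀~p₁ p₁~p₂ p₀≢p₂ p₁∉X (X-conn _ _ p₀∈X p₂∈X)

    p₄∉ : ∀ {X} → ConnectedIn G X → p₃ ∉ X → p₂ ∈ X → p₄ ∉ X
    p₄∉ X-conn p₃∉X p₂∈X p₄∈X =
      acyclic⇒no-detour G acyclic (Adj-sym G p₃~p₄) (Adj-sym G p₂~p₃) (p₂≢p₄ ∘ sym) p₃∉X (X-conn _ _ p₄∈X p₂∈X)

    right⇒¬left : ∀ {X y} → ConnectedIn G X → p₂ ∉ X → y ∈ X → y ≡ p₃ ⊎ y ≡ p₄ → p₀ ∉ X × p₁ ∉ X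
    right⇒¬left {X} X-conn p₂∉X y∈X y-right = avoided (inj₁ refl) , avoided (inj₂ refl)
      where
      X⊆ : X ⊆ ∁ ⁅ p₂ ⁆
      X⊆ u∈X = ∈∁⁅⁆ (λ { refl → p₂∉X u∈X })
      p₁∈ : p₁ ∈ ∁ ⁅ p₂ ⁆
      p₁∈ = ∈∁⁅⁆ (Adj⇒≢ G p₁~p₂)
      p₃∈ : p₃ ∈ ∁ ⁅ p₂ ⁆
      p₃∈ = ∈∁⁅⁆ (Adj⇒≢ G p₂~p₃ ∘ sym)
      from-p₁ : ∀ {x} → x ≡ p₀ ⊎ x ≡ p₁ → Reach G (∁ ⁅ p₂ ⁆) p₁ x
      from-p₁ (inj₁ refl) = reach-edge G p₁∈ (Adj-sym G p₀~p₁) (∈∁⁅⁆ p₀≢p₂)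
      from-p₁ (inj₂ refl) = here p₁∈
      to-p₃ : ∀ {y} → y ≡ p₃ ⊎ y ≡ p₄ → Reach G (∁ ⁅ p₂ ⁆) y p₃
      to-p₃ (inj₁ refl) = here p₃∈
      to-p₃ (inj₂ refl) = reach-edge G (∈∁⁅⁆ (p₂≢p₄ ∘ sym)) (Adj-sym G p₃~p₄) p₃∈
      avoided : ∀ {x} → x ≡ p₀ ⊎ x ≡ p₁ → x ∉ X
      avoided x-left x∈X = acyclic⇒no-detour G acyclic p₁~p₂ p₂~p₃ p₁≢p₃ (∉∁⁅⁆ p₂)
        (reach-trans G (from-p₁ x-left) (reach-trans G (reach-mono G X⊆ (X-conn _ _ x∈X y∈X)) (to-p₃ y-right)))

    module _ {S} (S-safe : IsSafe G w S) (S-conn : ConnectedIn G S) where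

      centre-in : p₂ ∈ S → p₁ ∉ S → heavy 10 < wsum w S
      centre-in p₂∈S p₁∉S with p₃ ∈? S | p₄ ∈? S
      ... | yes p₃∈S | yes p₄∈S =
        ℚ.<-≤-trans (heavy-< (from-yes (10 ℕ.<? 11)))
          (lower ((p₂≢p₃ ∷ p₂≢p₄ ∷ []) ∷ (p₃≢p₄ ∷ []) ∷ [] ∷ []) (p₂∈S ∷ p₃∈S ∷ p₄∈S ∷ []) (w₂ ∷ w₃ ∷ w₄ ∷ []))
      ... | no  p₃∉S | yes p₄∈S = ⊥-elim (p₄∉ S-conn p₃∉S p₂∈S p₄∈S)
      ... | _        | no  p₄∉S =
        ⊥-elim (heavy-squeeze nine
                  (upper (inj₁ p₀∉S ∷ inj₁ p₁∉S ∷ inj₂ (here refl) ∷ inj₂ (there (here refl)) ∷ inj₁ p₄∉S ∷ [])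
                         (w₂ ∷ w₃ ∷ []))
                  (from-yes (8 ℕ.<? 9)))
        where
        p₀∉S : p₀ ∉ S
        p₀∉S = p₀∉ S-conn p₁∉S p₂∈S
        p₁∈∁S : p₁ ∈ ∁ S
        p₁∈∁S = x∉p⇒x∈∁p p₁∉S
        nine : heavy 9 ≤ wsum w S
        nine = ℚ.≤-trans
          (lower ((p₀≢p₁ ∷ []) ∷ [] ∷ [])
                 (∈component⁺ G (reach-edge G p₁∈∁S (Adj-sym G p₀~p₁) (x∉p⇒x∈∁p p₀∉S)) ∷ x∈component G p₁∈∁S ∷ [])
                 (w₀ ∷ w₁ ∷ []))
          (safe⇒∁component≤ G w≥0 G-conn S-safe p₁∉S)

      centre-out : p₂ ∉ S → p₃ ∉ S → p₄ ∉ S → heavy 10 < wsum w S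
      centre-out p₂∉S p₃∉S p₄∉S =
        ℚ.<-≤-trans (heavy-< (from-yes (10 ℕ.<? 11)))
          (ℚ.≤-trans (lower ((p₂≢p₃ ∷ p₂≢p₄ ∷ []) ∷ (p₃≢p₄ ∷ []) ∷ [] ∷ [])
                            (x∈component G p₂∈∁S ∷ ∈component⁺ G p₂⇝p₃
                               ∷ ∈component⁺ G (step p₂⇝p₃ p₃~p₄ (x∉p⇒x∈∁p p₄∉S)) ∷ [])
                            (w₂ ∷ w₃ ∷ w₄ ∷ []))
                     (safe⇒∁component≤ G w≥0 G-conn S-safe p₂∉S))
        where
        p₂∈∁S : p₂ ∈ ∁ S
        p₂∈∁S = x∉p⇒x∈∁p p₂∉S
        p₂⇝p₃ : Reach G (∁ S) p₂ p₃
        p₂⇝p₃ = reach-edge G p₂∈∁S p₂~p₃ (x∉p⇒x∈∁p p₃∉S)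

    S₀ : Subset N
    S₀ = ⁅ p₁ ⁆ ∪ ⁅ p₃ ⁆

    S₀≤ : wsum w S₀ ≤ heavy 10
    S₀≤ = begin
      wsum w S₀             ≤⟨ wsum-⁅⁆∪ w≥0 p₁ ⁅ p₃ ⁆ ⟩
      w p₁ + wsum w ⁅ p₃ ⁆  ≡⟨ cong₂ _+_ w₁ (trans (wsum-⁅⁆ w p₃) w₃) ⟩
      heavy 5 + heavy 5     ≡⟨ heavy-+ 5 5 ⟩
      heavy 10              ∎
      where open ℚ.≤-Reasoning

    avoiding-p₁-p₃ : ∀ {D} → ConnectedIn G D → p₁ ∉ D → p₃ ∉ D → wsum w D ≤ heavy 5
    avoiding-p₁-p₃ {D} D-conn p₁∉D p₃∉D with p₂ ∈? D
    ... | yes p₂∈D = ℚ.<⇒≤ (ℚ.≤-<-trans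
            (upper (inj₁ (p₀∉ D-conn p₁∉D p₂∈D) ∷ inj₁ p₁∉D ∷ inj₂ (here refl) ∷ inj₁ p₃∉D
                      ∷ inj₁ (p₄∉ D-conn p₃∉D p₂∈D) ∷ [])
                   (w₂ ∷ []))
            (heavy-< (from-yes (3 ℕ.<? 5))))
    ... | no p₂∉D with p₀ ∈? D
    ...   | yes p₀∈D = upper (inj₂ (here refl) ∷ inj₁ p₁∉D ∷ inj₁ p₂∉D ∷ inj₁ p₃∉D ∷ inj₁ p₄∉D ∷ []) (w₀ ∷ [])
      where
      p₄∉D : p₄ ∉ D
      p₄∉D p₄∈D = proj₁ (right⇒¬left D-conn p₂∉D p₄∈D (inj₂ refl)) p₀∈D
    ...   | no  p₀∉D = upper (inj₁ p₀∉D ∷ inj₁ p₁∉D ∷ inj₁ p₂∉D ∷ inj₁ p₃∉D ∷ inj₂ (here refl) ∷ []) (w₄ ∷ [])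

    -- p₁ and p₃ cut the path into p₀, p₂ and p₄, and a component of ∁ S₀ contains at most one of them.
    S₀-safe : IsSafe G w S₀
    S₀-safe = (p₁ , x∈p∪q⁺ (inj₁ (x∈⁅x⁆ p₁))) , λ C D C-comp D-comp _ → ℚ.≤-trans (D≤ D-comp) (≤C C-comp)
      where
      ≤C : ∀ {C} → IsComponent G S₀ C → heavy 5 ≤ wsum w C
      ≤C ((c , c∈C) , C⊆S₀ , _) with x∈p∪q⁻ ⁅ p₁ ⁆ ⁅ p₃ ⁆ (C⊆S₀ c∈C)
      ... | inj₁ c∈⁅p₁⁆ = subst (_≤ _) (trans (cong w (x∈⁅y⁆⇒x≡y p₁ c∈⁅p₁⁆)) w₁) (w≤wsum w≥0 c∈C)
      ... | inj₂ c∈⁅p₃⁆ = subst (_≤ _) (trans (cong w (x∈⁅y⁆⇒x≡y p₃ c∈⁅p₃⁆)) w₃) (w≤wsum w≥0 c∈C)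
      D≤ : ∀ {D} → IsComponent G (∁ S₀) D → wsum w D ≤ heavy 5
      D≤ (_ , D⊆∁S₀ , D-conn , _) = avoiding-p₁-p₃ D-conn
        (λ p₁∈D → x∈∁p⇒x∉p (D⊆∁S₀ p₁∈D) (x∈p∪q⁺ (inj₁ (x∈⁅x⁆ p₁))))
        (λ p₃∈D → x∈∁p⇒x∉p (D⊆∁S₀ p₃∈D) (x∈p∪q⁺ (inj₂ (x∈⁅x⁆ p₃))))

  module _ (P : Path₅ G) {w : Weight N} (pw : PathWeight P w) (w≥0 : NonNegative w) where
    open Path₅ P
    open PathWeight pw
    open OnPath P pw w≥0
    private
      module ← = OnPath (reverse G P) (reverse-weight pw) w≥0

    connSafe-heavy : ∀ {S} → IsConnSafe G w S → heavy 10 < wsum w S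
    connSafe-heavy {S} (S-safe , S-conn) with p₂ ∈? S
    ... | yes p₂∈S with p₁ ∈? S | p₃ ∈? S
    ...   | no  p₁∉S | _        = centre-in S-safe S-conn p₂∈S p₁∉S
    ...   | yes _    | no  p₃∉S = ←.centre-in S-safe S-conn p₂∈S p₃∉S
    ...   | yes p₁∈S | yes p₃∈S =
      ℚ.<-≤-trans (heavy-< (from-yes (10 ℕ.<? 12)))
        (lower ((p₁≢p₂ ∷ p₁≢p₃ ∷ []) ∷ (p₂≢p₃ ∷ []) ∷ [] ∷ []) (p₁∈S ∷ p₂∈S ∷ p₃∈S ∷ []) (w₁ ∷ w₂ ∷ w₃ ∷ []))
    connSafe-heavy {S} (S-safe , S-conn) | no p₂∉S with p₃ ∈? S | p₄ ∈? S
    ... | no  p₃∉S | no p₄∉S = centre-out S-safe S-conn p₂∉S p₃∉S p₄∉S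
    ... | yes p₃∈S | _        =
      let p₀∉S , p₁∉S = right⇒¬left S-conn p₂∉S p₃∈S (inj₁ refl) in ←.centre-out S-safe S-conn p₂∉S p₁∉S p₀∉S
    ... | no  _    | yes p₄∈S =
      let p₀∉S , p₁∉S = right⇒¬left S-conn p₂∉S p₄∈S (inj₂ refl) in ←.centre-out S-safe S-conn p₂∉S p₁∉S p₀∉S

  infixl 5 _[_↦_]
  opaque
    _[_↦_] : Weight N → Fin N → ℚ → Weight N
    w [ x ↦ q ] = updateAt w x (λ _ → q)

    ↦-hit : ∀ {w x q} → (w [ x ↦ q ]) x ≡ q
    ↦-hit {w} {x} = updateAt-updates x w

    ↦-miss : ∀ {w x y q} → y ≢ x → (w [ x ↦ q ]) y ≡ w y
    ↦-miss {w} {x} {y} y≢x = updateAt-minimal y x w y≢x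

  ↦-positive : ∀ {w x q} → Positive w → 0ℚ < q → Positive (w [ x ↦ q ])
  ↦-positive {w} {x} w>0 q>0 y with y ≟ x
  ... | yes refl = subst (0ℚ <_) (sym ↦-hit) q>0
  ... | no  y≢x  = subst (0ℚ <_) (sym (↦-miss y≢x)) (w>0 y)

  module _ (P : Path₅ G) where
    open Path₅ P

    pathWeight : Weight N
    pathWeight = (λ _ → 1ℚ) [ p₀ ↦ heavy 4 ] [ p₁ ↦ heavy 5 ] [ p₂ ↦ heavy 2 ] [ p₃ ↦ heavy 5 ] [ p₄ ↦ heavy 4 ]

    pathWeight-positive : Positive pathWeight
    pathWeight-positive =
      ↦-positive (↦-positive (↦-positive (↦-positive (↦-positive (λ _ → 0<1)
        (heavy-positive 3)) (heavy-positive 4)) (heavy-positive 1)) (heavy-positive 4)) (heavy-positive 3)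

    pathWeight-isPathWeight : PathWeight P pathWeight
    pathWeight-isPathWeight = record
      { w₀ = trans (↦-miss p₀≢p₄) (trans (↦-miss p₀≢p₃) (trans (↦-miss p₀≢p₂) (trans (↦-miss p₀≢p₁) ↦-hit)))
      ; w₁ = trans (↦-miss p₁≢p₄) (trans (↦-miss p₁≢p₃) (trans (↦-miss p₁≢p₂) ↦-hit))
      ; w₂ = trans (↦-miss p₂≢p₄) (trans (↦-miss p₂≢p₃) ↦-hit)
      ; w₃ = trans (↦-miss p₃≢p₄) ↦-hit
      ; w₄ = ↦-hit
      ; off-path = λ { v (≢₀ ∷ ≢₁ ∷ ≢₂ ∷ ≢₃ ∷ ≢₄ ∷ []) →
          trans (↦-miss ≢₄) (trans (↦-miss ≢₃) (trans (↦-miss ≢₂) (trans (↦-miss ≢₁) (↦-miss ≢₀)))) }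
      }

    Path₅⇒¬InGcs : ¬ InGcs G
    Path₅⇒¬InGcs = ¬InGcs-intro G G-conn pathWeight pathWeight-positive S₀ S₀-safe
      (λ _ S′-connSafe → ℚ.≤-<-trans S₀≤ (connSafe-heavy P pathWeight-isPathWeight w≥0 S′-connSafe))
      where
      w≥0 : NonNegative pathWeight
      w≥0 = positive⇒nonNegative pathWeight-positive
      open OnPath P pathWeight-isPathWeight w≥0

InGcs⇒diameter≤3 : ∀ {n} (T : Graph n) → IsTree T → InGcs T → ∀ u v → DistLe T 3 u v
InGcs⇒diameter≤3 {zero}  T (() , _)
InGcs⇒diameter≤3 {suc m} T (_ , T-conn , acyclic) inGcs u v =
  decidable-stable (DistLe? T 3 u v) (λ far → Path₅⇒¬InGcs acyclic T-conn (far⇒Path₅ T T-conn far) inGcs)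

corollary4p4 : (n : ℕ) (T : Graph n) → IsTree T → (InGcs T ⇔ IsDoubleStar T)
corollary4p4 n T T-tree = mk⇔ (λ inGcs → T-tree , InGcs⇒diameter≤3 T T-tree inGcs) (doubleStar⇒InGcs T)
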